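{- Let $D\ge2$ be squarefree, $K=\mathbb{Q}(\sqrt D)$, $m$ a positive integer, $i\ge-1$ odd and $0\le r\le u_{i+2}-1$. Then $p_K(2\alpha_{i,r})=m$ if and only if either ($r=m-2$ and $u_{i+2}\ge 2m-4$) or ($r=u_{i+2}-(m-2)$ and $u_{i+2}\ge2m-3$). Moreover, $p_K(\alpha_{i,r}+\alpha_{i,r+1})=m$ if and only if either ($r=m-2$ and $u_{i+2}\ge2m-3$) or ($r=u_{i+2}-(m-1)$ and $u_{i+2}\ge2m-2$).
   Context: $\mathcal{O}_K^+$: totally positive integers of $K$; $p_K(\alpha)$ is the number of unordered representations $\alpha=\lambda_1+\dots+\lambda_\ell$ ($\ell\ge1$, $\lambda_i\in\mathcal{O}_K^+$). Notation: $\omega_D=\sqrt D$, $\xi_D=\sqrt D$ if $D\equiv2,3\pmod4$; $\omega_D=(1+\sqrt D)/2$, $\xi_D=(\sqrt D-1)/2$ if $D\equiv1\pmod4$. Write $\omega_D=[\lceil u_0/2\rceil;\overline{u_1,\dots,u_s}]$ with $u_s=u_0$ (indices extended periodically). Let $p_{ -1}=1,q_{ -1}=0$, $p_0=\lceil u_0/2\rceil,q_0=1$, $p_{i+2}=u_{i+2}p_{i+1}+p_i$, $q_{i+2}=u_{i+2}q_{i+1}+q_i$, $\alpha_i=p_i+q_i\xi_D$, $\alpha_{i,r}=\alpha_i+r\alpha_{i+1}$ (so $\alpha_{i,u_{i+2}}=\alpha_{i+2,0}$). -}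

module Defs where

open import Data.Bool using (Bool; true; false; if_then_else_)
open import Data.Nat as ℕ using (ℕ; zero; suc; _≡ᵇ_; _≤ᵇ_; _%_)
open import Data.Nat.Divisibility using (_∣_)
open import Data.Integer as ℤ using (ℤ; +_; +[1+_]; -[1+_]; _+_; _*_; _-_; _<_)
open import Data.Integer.DivMod using (_/ℕ_)
open import Data.Product using (_×_; _,_; proj₁; proj₂; ∃-syntax)
open import Data.Fin using (Fin)
open import Data.List using (List; []; _∷_; foldr)
open import Data.List.Relation.Unary.All using (All)
open import Data.List.Relation.Binary.Permutation.Propositional using (_↭_)
open import Relation.Binary.PropositionalEquality using (_≡_)

SquareFree : ℕ → Set
SquareFree D = ∀ (p : ℕ) → (p ℕ.* p) ∣ D → p ≡ 1

oneMod4 : ℕ → Bool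
oneMod4 D = (D % 4) ≡ᵇ 1

-- Elements of O_K, K = Q(√D), written in the integral basis (1, ω_D):
-- the pair (a , b) stands for a + b·ω_D.
OK : Set
OK = ℤ × ℤ

_⊕_ : OK → OK → OK
(a , b) ⊕ (c , d) = (a + c , b + d)

zeroK : OK
zeroK = (+ 0 , + 0)

_⊙_ : ℕ → OK → OK
n ⊙ (a , b) = (+ n * a , + n * b)

sumK : List OK → OK
sumK = foldr _⊕_ zeroK

-- ξ_D = ω_D (D ≡ 2,3 mod 4) and ξ_D = ω_D - 1 (D ≡ 1 mod 4)
ξ : ℕ → OK
ξ D = if oneMod4 D then (ℤ.- + 1 , + 1) else (+ 0 , + 1)

-- Write x = (c + e√D)/t with t = 2 if D ≡ 1 (mod 4) and t = 1 otherwise;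
-- sqrtCoords returns (c , e).
sqrtCoords : ℕ → OK → ℤ × ℤ
sqrtCoords D (a , b) = if oneMod4 D then (+ 2 * a + b , b) else (a , b)

-- x is totally positive: both real embeddings c + e√D and c - e√D are > 0,
-- which (for c, e ∈ ℤ, D > 0) is equivalent to  c > 0  and  e²·D < c².
TotPos : ℕ → OK → Set
TotPos D x = let (c , e) = sqrtCoords D x in
             (+ 0 < c) × (e * e * + D < c * c)

-- Partitions: a representation of α as an (unordered) sum
-- α = λ₁ + … + λ_ℓ, ℓ ≥ 1, λᵢ totally positive, is a nonempty list of
-- totally positive elements summing to α; two lists are the same
-- unordered representation iff they are permutations of each other.
NonEmpty : {A : Set} → List A → Set
NonEmpty [] = Data.Empty.⊥ where import Data.Empty
NonEmpty (_ ∷ _) = Data.Unit.⊤ where import Data.Unit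

IsRep : ℕ → OK → List OK → Set
IsRep D α xs = NonEmpty xs × All (TotPos D) xs × (sumK xs ≡ α)

-- "p_K(α) = m": the unordered representations of α are in bijection with
-- Fin m (a list of m pairwise non-permutation-equivalent representations,
-- exhausting all representations up to permutation).
record PartitionCount (D : ℕ) (α : OK) (m : ℕ) : Set where
  field
    reps     : Fin m → List OK
    isRep    : ∀ k → IsRep D α (reps k)
    distinct : ∀ k l → reps k ↭ reps l → k ≡ l
    complete : ∀ xs → IsRep D α xs → ∃[ k ] (xs ↭ reps k)

-- Continued fraction expansion of ω_D = [a₀; a₁, a₂, …]
-- (standard algorithm for quadratic irrationals x_k = (P_k + √D)/Q_k:
--  a_k = ⌊x_k⌋ = ⌊(P_k + ⌊√D⌋)/Q_k⌋, P_{k+1} = a_k Q_k - P_k,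
--  Q_{k+1} = (D - P_{k+1}²)/Q_k).

isqrt : ℕ → ℕ
isqrt D = go D
  where
  go : ℕ → ℕ
  go zero = zero
  go (suc k) = if (suc k ℕ.* suc k) ≤ᵇ D then suc k else go k

-- floor division by a positive integer (junk value 0 otherwise; Q_k > 0
-- always holds in the algorithm)
divPos : ℤ → ℤ → ℤ
divPos n +[1+ q ] = n /ℕ suc q
divPos n _        = + 0

-- initial complete quotient ω_D = (P₀ + √D)/Q₀
cfInit : ℕ → ℤ × ℤ
cfInit D = if oneMod4 D then (+ 1 , + 2) else (+ 0 , + 1)

cfState : ℕ → ℕ → ℤ × ℤ
cfState D zero    = cfInit D
cfState D (suc k) =
  let (P , Q) = cfState D k
      a  = divPos (P + + isqrt D) Q
      P' = a * Q - P
      Q' = divPos (+ D - P' * P') Q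
  in (P' , Q')

cfa : ℕ → ℕ → ℤ
cfa D k = let (P , Q) = cfState D k in divPos (P + + isqrt D) Q

-- u_k for k ≥ 1 (u_k = a_k); a₀ = ⌈u₀/2⌉.
u : ℕ → ℕ → ℤ
u D k = cfa D k

-- Shifted convergent data: P j = p_{j-1}, Qc j = q_{j-1} (j ≥ 0).
-- p_{-1}=1, q_{-1}=0, p_0 = ⌈u₀/2⌉ = a₀, q_0 = 1,
-- p_{i+2} = u_{i+2} p_{i+1} + p_i, same for q.
pq : ℕ → ℕ → ℤ × ℤ
pq D zero          = (+ 1 , + 0)
pq D (suc zero)    = (cfa D 0 , + 1)
pq D (suc (suc j)) =
  let (p₁ , q₁) = pq D (suc j)
      (p₀ , q₀) = pq D j
      c = u D (suc j)
  in (c * p₁ + p₀ , c * q₁ + q₀)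

-- alphaS D j = α_{j-1} = p_{j-1} + q_{j-1} ξ_D
alphaS : ℕ → ℕ → OK
alphaS D j = let (p , q) = pq D j in (p , + 0) ⊕ (q ⊗ ξ D)
  where
  _⊗_ : ℤ → OK → OK
  c ⊗ (a , b) = (c * a , c * b)

-- alphaSR D j r = α_{j-1,r} = α_{j-1} + r α_j
alphaSR : ℕ → ℕ → ℕ → OK
alphaSR D j r = alphaS D j ⊕ (r ⊙ alphaS D (suc j))

{-# OPTIONS --safe #-}
module Submission where

-- Let i be odd, α = α_i and α′ = α_{i+1}. The complete quotients (P_k + √D)/Q_k of ω_D are
-- reduced, so Q_k > 0, and the convergent identities make (α, α′) a basis of O_K of determinant 1
-- with N(α) > 0 > N(α′). Writing x = S x · α + T x · α′, this gives: every totally positive x has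
-- S x ≥ 1, and α + τα′ is totally positive exactly when 0 ≤ τ ≤ u_{i+2}. Both 2α_{i,r} and
-- α_{i,r} + α_{i,r+1} are (α + rα′) + (α + r′α′) with r′ = r resp. r + 1, so S = 2 for them. As S
-- is additive, a partition is then the element itself or a sum (α + tα′) + (α + t′α′) with
-- t + t′ = r + r′ and 0 ≤ t, t′ ≤ u_{i+2}. There are min(r, u_{i+2} - r′) + 1 such unordered pairs,
-- so p_K = 2 + min(r, u_{i+2} - r′), which unfolds to the stated case distinction.

open import Defs
open import Data.Nat as ℕ using (ℕ)
open import Data.Integer as ℤ using (ℤ; +_; _-_)
open import Data.Sum using (_⊎_)
open import Data.Product using (_×_)
open import Function.Bundles using (_⇔_)
open import Relation.Binary.PropositionalEquality using (_≡_)

module IntegerOrder where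

  open import Data.Nat using (z≤n)
  open import Data.Integer
  open import Data.Integer.Properties
  open import Data.Integer.Tactic.RingSolver
  open import Data.Empty using (⊥)
  open import Data.List using ([]; _∷_)
  open import Data.Product using (_×_; _,_)
  open import Function using (_∘_)
  open import Relation.Binary.PropositionalEquality
  open import Relation.Nullary using (¬_)

  -- Inequalities throughout are proved by certificates: the ring solver rewrites the quantity in
  -- question into a sum of products of quantities already known to be nonnegative.

  nonNeg-≡ : ∀ x {y} → x ≡ y → 0ℤ ≤ x → 0ℤ ≤ y
  nonNeg-≡ x refl 0≤x = 0≤x

  pos-≡ : ∀ x {y} → x ≡ y → 0ℤ < x → 0ℤ < y
  pos-≡ x refl 0<x = 0<x

  ≤⇒0≤- : ∀ {x y} → x ≤ y → 0ℤ ≤ y - x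
  ≤⇒0≤- = i≤j⇒0≤j-i

  0≤-⇒≤ : ∀ {x y} → 0ℤ ≤ y - x → x ≤ y
  0≤-⇒≤ = 0≤i-j⇒j≤i

  <⇒0≤-1 : ∀ {x y} → x < y → 0ℤ ≤ y - x - 1ℤ
  <⇒0≤-1 {x} {y} x<y = nonNeg-≡ (y - (1ℤ + x)) (solve (x ∷ y ∷ [])) (≤⇒0≤- (i<j⇒suc[i]≤j x<y))

  0≤-1⇒< : ∀ {x y} → 0ℤ ≤ y - x - 1ℤ → x < y
  0≤-1⇒< {x} {y} 0≤y-x-1 = suc[i]≤j⇒i<j (0≤-⇒≤ {1ℤ + x} (nonNeg-≡ (y - x - 1ℤ) (solve (x ∷ y ∷ [])) 0≤y-x-1))

  <⇒0<- : ∀ {x y} → x < y → 0ℤ < y - x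
  <⇒0<- {x} {y} x<y = 0≤-1⇒< (nonNeg-≡ (y - x - 1ℤ) (solve (x ∷ y ∷ [])) (<⇒0≤-1 x<y))

  0<-⇒< : ∀ {x y} → 0ℤ < y - x → x < y
  0<-⇒< {x} {y} 0<y-x = 0≤-1⇒< (nonNeg-≡ (y - x - 0ℤ - 1ℤ) (solve (x ∷ y ∷ [])) (<⇒0≤-1 0<y-x))

  i<j+1⇒i≤j : ∀ {i j} → i < j + 1ℤ → i ≤ j
  i<j+1⇒i≤j {i} {j} i<j+1 = 0≤-⇒≤ (nonNeg-≡ (j + 1ℤ - i - 1ℤ) (solve (i ∷ j ∷ [])) (<⇒0≤-1 i<j+1))

  +-nonNeg : ∀ {x y} → 0ℤ ≤ x → 0ℤ ≤ y → 0ℤ ≤ x + y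
  +-nonNeg = +-mono-≤

  +-pos : ∀ {x y} → 0ℤ < x → 0ℤ ≤ y → 0ℤ < x + y
  +-pos = +-mono-<-≤

  *-nonNeg : ∀ {x y} → 0ℤ ≤ x → 0ℤ ≤ y → 0ℤ ≤ x * y
  *-nonNeg {+ m} {+ n} _ _ = subst (0ℤ ≤_) (pos-* m n) (+≤+ z≤n)

  *-pos : ∀ {x y} → 0ℤ < x → 0ℤ < y → 0ℤ < x * y
  *-pos {x} {y} 0<x 0<y = 0≤-1⇒< (nonNeg-≡ ((x - 0ℤ - 1ℤ) * (y - 0ℤ - 1ℤ) + (x - 0ℤ - 1ℤ) + (y - 0ℤ - 1ℤ))
    (solve (x ∷ y ∷ [])) (+-nonNeg (+-nonNeg (*-nonNeg (<⇒0≤-1 0<x) (<⇒0≤-1 0<y)) (<⇒0≤-1 0<x)) (<⇒0≤-1 0<y)))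

  0≤i*i : ∀ i → 0ℤ ≤ i * i
  0≤i*i (+ n)    = *-nonNeg {+ n} (+≤+ z≤n) (+≤+ z≤n)
  0≤i*i -[1+ n ] = +≤+ z≤n

  -1≱0 : ¬ (0ℤ ≤ -1ℤ)
  -1≱0 ()

  ≤-by-contradiction : ∀ {x y} → (0ℤ ≤ x - y - 1ℤ → ⊥) → x ≤ y
  ≤-by-contradiction contra = ≮⇒≥ (contra ∘ <⇒0≤-1)

  <-by-contradiction : ∀ {x y} → (0ℤ ≤ x - y → ⊥) → x < y
  <-by-contradiction contra = ≰⇒> (contra ∘ ≤⇒0≤-)

  0<i*j⇒0<j : ∀ {i j} → 0ℤ ≤ i → 0ℤ < i * j → 0ℤ < j
  0<i*j⇒0<j {i} {j} 0≤i 0<ij = <-by-contradiction λ j≤0 →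
    -1≱0 (nonNeg-≡ (i * (0ℤ - j) + (i * j - 0ℤ - 1ℤ)) (solve (i ∷ j ∷ []))
      (+-nonNeg (*-nonNeg 0≤i j≤0) (<⇒0≤-1 0<ij)))

  i*i<j*j⇒i<j : ∀ {i j} → 0ℤ ≤ j → i * i < j * j → i < j
  i*i<j*j⇒i<j {i} {j} 0≤j i²<j² = <-by-contradiction λ j≤i →
    -1≱0 (nonNeg-≡ ((i - j) * ((i - j) + (j + j)) + (j * j - i * i - 1ℤ)) (solve (i ∷ j ∷ []))
      (+-nonNeg (*-nonNeg j≤i (+-nonNeg j≤i (+-nonNeg 0≤j 0≤j))) (<⇒0≤-1 i²<j²)))

  -j≤i≤j⇒i*i≤j*j : ∀ {i j} → - j ≤ i → i ≤ j → i * i ≤ j * j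
  -j≤i≤j⇒i*i≤j*j {i} {j} -j≤i i≤j =
    0≤-⇒≤ (nonNeg-≡ ((j - i) * (i - - j)) (solve (i ∷ j ∷ [])) (*-nonNeg (≤⇒0≤- i≤j) (≤⇒0≤- -j≤i)))

  i*i<[j+1]²⇒-j≤i≤j : ∀ {i j} → 0ℤ ≤ j → i * i < (j + 1ℤ) * (j + 1ℤ) → - j ≤ i × i ≤ j
  i*i<[j+1]²⇒-j≤i≤j {i} {j} 0≤j i²<[j+1]² =
    0≤-⇒≤ (nonNeg-≡ (j + 1ℤ - - i - 1ℤ) (solve (i ∷ j ∷ [])) (<⇒0≤-1 (i*i<j*j⇒i<j 0≤j+1 -i²<[j+1]²))) ,
    0≤-⇒≤ (nonNeg-≡ (j + 1ℤ - i - 1ℤ) (solve (i ∷ j ∷ [])) (<⇒0≤-1 (i*i<j*j⇒i<j 0≤j+1 i²<[j+1]²)))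
    where
    0≤j+1 : 0ℤ ≤ j + 1ℤ
    0≤j+1 = +-nonNeg 0≤j (+≤+ z≤n)
    square-neg : ∀ i → i * i ≡ - i * - i
    square-neg = solve-∀
    -i²<[j+1]² : - i * - i < (j + 1ℤ) * (j + 1ℤ)
    -i²<[j+1]² = subst (_< (j + 1ℤ) * (j + 1ℤ)) (square-neg i) i²<[j+1]²

  i+j≡k⇒i≡k-j : ∀ {i j k} → i + j ≡ k → i ≡ k - j
  i+j≡k⇒i≡k-j {i} {j} refl = solve (i ∷ j ∷ [])

  i-j≡k⇒i≡k+j : ∀ {i j k} → i - j ≡ k → i ≡ k + j
  i-j≡k⇒i≡k+j {i} {j} refl = solve (i ∷ j ∷ [])

  i-j≡i-k⇒j≡k : ∀ {i j k} → i - j ≡ i - k → j ≡ k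
  i-j≡i-k⇒j≡k {i} {j} {k} i-j≡i-k = begin
    j             ≡⟨ solve (i ∷ j ∷ []) ⟩
    i - (i - j)   ≡⟨ cong (λ x → i - x) i-j≡i-k ⟩
    i - (i - k)   ≡⟨ solve (i ∷ k ∷ []) ⟩
    k             ∎
    where open ≡-Reasoning

  i+j≡2⇒i≡1 : ∀ {i j} → 0ℤ < i → 0ℤ < j → i + j ≡ + 2 → i ≡ 1ℤ
  i+j≡2⇒i≡1 {i} {j} 0<i 0<j i+j≡2 =
    ≤-antisym (0≤-⇒≤ (nonNeg-≡ (j - 0ℤ - 1ℤ) j-1≡1-i (<⇒0≤-1 0<j))) (i<j⇒suc[i]≤j 0<i)
    where
    open ≡-Reasoning
    j-1≡1-i : j - 0ℤ - 1ℤ ≡ 1ℤ - i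
    j-1≡1-i = begin
      j - 0ℤ - 1ℤ       ≡⟨ solve (i ∷ j ∷ []) ⟩
      (i + j) - i - 1ℤ  ≡⟨ cong (λ z → z - i - 1ℤ) i+j≡2 ⟩
      + 2 - i - 1ℤ      ≡⟨ solve (i ∷ []) ⟩
      1ℤ - i            ∎

module Floors where

  open IntegerOrder
  open import Data.Nat as ℕ using (ℕ; zero; suc; z≤n; s≤s)
  import Data.Nat.Properties as ℕ
  open import Data.Integer hiding (suc)
  open import Data.Integer.Properties
  open import Data.Integer.DivMod using ([n/ℕd]*d≤n; n<s[n/ℕd]*d)
  open import Data.Integer.Tactic.RingSolver
  open import Data.Bool using (true; false; T)
  open import Data.List using ([]; _∷_)
  open import Data.Product using (_×_; _,_; uncurry)
  open import Data.Sum using (inj₁; inj₂)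
  open import Data.Nat.Divisibility using (divides)
  open import Relation.Binary.PropositionalEquality
  open import Relation.Nullary using (contradiction)

  divPos-floor : ∀ n {Q} → 0ℤ < Q → divPos n Q * Q ≤ n × n < (1ℤ + divPos n Q) * Q
  divPos-floor n {+[1+ q ]} _ = [n/ℕd]*d≤n n (suc q) , n<s[n/ℕd]*d n (suc q)
  divPos-floor n {+0} (+<+ ())

  quotient-unique : ∀ {Q m d} → 0ℤ < Q → d * Q ≤ Q * m → Q * m < (1ℤ + d) * Q → d ≡ m
  quotient-unique {Q} {m} {d} 0<Q dQ≤Qm Qm<[1+d]Q = ≤-antisym d≤m m≤d
    where
    d≤m : d ≤ m
    d≤m = ≤-by-contradiction λ m<d → -1≱0 (nonNeg-≡ (Q * (d - m - 1ℤ) + (Q - 0ℤ - 1ℤ) + (Q * m - d * Q))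
            (solve (Q ∷ m ∷ d ∷ [])) (+-nonNeg (+-nonNeg (*-nonNeg (<⇒≤ 0<Q) m<d) (<⇒0≤-1 0<Q)) (≤⇒0≤- dQ≤Qm)))
    m≤d : m ≤ d
    m≤d = ≤-by-contradiction λ d<m → -1≱0 (nonNeg-≡ (Q * (m - d - 1ℤ) + ((1ℤ + d) * Q - Q * m - 1ℤ))
            (solve (Q ∷ m ∷ d ∷ [])) (+-nonNeg (*-nonNeg (<⇒≤ 0<Q) d<m) (<⇒0≤-1 Qm<[1+d]Q)))

  divPos-exact : ∀ m {Q} → 0ℤ < Q → divPos (Q * m) Q ≡ m
  divPos-exact m {Q} 0<Q = uncurry (quotient-unique 0<Q) (divPos-floor (Q * m) 0<Q)

  private
    mutual
      isqrt-worker : ℕ → ℕ → ℕ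
      isqrt-worker = _

      -- Names the local worker go of isqrt (not otherwise accessible): after the rewrites the goal
      -- is the pattern  go D n ≡ isqrt-worker D n,  whose solution makes isqrt D ≡ isqrt-worker D D
      -- hold definitionally.
      isqrt-worker-solution : ∀ n D → suc n ≡ D → (suc n ℕ.* suc n ℕ.≤ᵇ suc n) ≡ false →
                              isqrt (suc n) ≡ isqrt-worker D n
      isqrt-worker-solution n D e b rewrite b | e = refl

    isqrt-worker-sq≤ : ∀ D k → isqrt-worker D k ℕ.* isqrt-worker D k ℕ.≤ D
    isqrt-worker-sq≤ D zero = z≤n
    isqrt-worker-sq≤ D (suc k) with suc k ℕ.* suc k ℕ.≤ᵇ D in eq
    ... | true = ℕ.≤ᵇ⇒≤ (suc k ℕ.* suc k) D (subst T (sym eq) _)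
    ... | false = isqrt-worker-sq≤ D k

    isqrt-worker-sq> : ∀ D k → D ℕ.< suc k ℕ.* suc k →
                       D ℕ.< suc (isqrt-worker D k) ℕ.* suc (isqrt-worker D k)
    isqrt-worker-sq> D zero D<1 = D<1
    isqrt-worker-sq> D (suc k) D<[k+2]² with suc k ℕ.* suc k ℕ.≤ᵇ D in eq
    ... | true = D<[k+2]²
    ... | false = isqrt-worker-sq> D k (ℕ.≰⇒> λ [k+1]²≤D → subst T eq (ℕ.≤⇒≤ᵇ [k+1]²≤D))

  isqrt-sq≤ : ∀ D → isqrt D ℕ.* isqrt D ℕ.≤ D
  isqrt-sq≤ D = isqrt-worker-sq≤ D D

  isqrt-sq> : ∀ D → D ℕ.< suc (isqrt D) ℕ.* suc (isqrt D)
  isqrt-sq> D = isqrt-worker-sq> D D (s≤s (ℕ.≤-trans (ℕ.m≤m*n D (suc D)) (ℕ.m≤n+m (D ℕ.* suc D) D)))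

  isqrt-sq< : ∀ D → 2 ℕ.≤ D → SquareFree D → isqrt D ℕ.* isqrt D ℕ.< D
  isqrt-sq< D 2≤D squarefree with ℕ.m≤n⇒m<n∨m≡n (isqrt-sq≤ D)
  ... | inj₁ s²<D = s²<D
  ... | inj₂ s²≡D = contradiction 2≤D (ℕ.<-irrefl (sym D≡1))
    where
    s≡1 : isqrt D ≡ 1
    s≡1 = squarefree (isqrt D) (divides 1 (sym (trans (ℕ.*-identityˡ _) s²≡D)))
    D≡1 : D ≡ 1
    D≡1 = trans (sym s²≡D) (cong (λ s → s ℕ.* s) s≡1)

module ReducedQuotients where

  open IntegerOrder
  open import Data.Nat using (z≤n)
  open import Data.Integer
  open import Data.Integer.Properties using (<⇒≤; ≤-trans; ≤-<-trans)
  open import Data.Integer.Tactic.RingSolver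
  open import Data.List using ([]; _∷_)
  open import Relation.Binary.PropositionalEquality

  -- A complete quotient (P + √D)/Q with s = ⌊√D⌋ and Q′ = (D - P²)/Q.
  record Reduced (s D P Q Q′ : ℤ) : Set where
    field
      0<Q      : 0ℤ < Q
      P≤s      : P ≤ s
      Q≤P+s    : Q ≤ P + s
      D≡QQ′+P² : D ≡ Q * Q′ + P * P

  record Reduction (s D P Q Q′ a : ℤ) : Set where
    field
      0<a     : 0ℤ < a
      reduced : Reduced s D (a * Q - P) (Q′ + + 2 * a * P - a * a * Q) Q
      0<P′    : 0ℤ < a * Q - P
      s<P′+Q″ : s < (a * Q - P) + (Q′ + + 2 * a * P - a * a * Q)

  reduce : ∀ {s D P Q Q′ a} → s * s < D → D < (s + 1ℤ) * (s + 1ℤ) → Reduced s D P Q Q′ →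
           a * Q ≤ P + s → P + s < (1ℤ + a) * Q → Reduction s D P Q Q′ a
  reduce {s} {_} {P} {Q} {Q′} {a} s²<D D<[s+1]²
         record { 0<Q = 0<Q ; P≤s = P≤s ; Q≤P+s = Q≤P+s ; D≡QQ′+P² = refl } aQ≤P+s P+s<[1+a]Q =
    record
      { 0<a     = 0<a
      ; reduced = record
        { 0<Q = 0<Q″ ; P≤s = P′≤s ; Q≤P+s = Q″≤P′+s
        ; D≡QQ′+P² = solve (s ∷ P ∷ Q ∷ Q′ ∷ a ∷ []) }
      ; 0<P′    = 0<P′
      ; s<P′+Q″ = s<P′+Q″
      }
    where
    0≤Q : 0ℤ ≤ Q
    0≤Q = <⇒≤ 0<Q
    0<a : 0ℤ < a
    0<a = 0<i*j⇒0<j 0≤Q (pos-≡ ((1ℤ + a) * Q - Q) (solve (a ∷ Q ∷ []))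
            (<⇒0<- (≤-<-trans Q≤P+s P+s<[1+a]Q)))
    P′≤s : a * Q - P ≤ s
    P′≤s = 0≤-⇒≤ (nonNeg-≡ (P + s - a * Q) (solve (s ∷ P ∷ Q ∷ a ∷ [])) (≤⇒0≤- aQ≤P+s))
    Q≤P′+s : Q ≤ a * Q - P + s
    Q≤P′+s = 0≤-⇒≤ (nonNeg-≡ ((a - 0ℤ - 1ℤ) * Q + (s - P)) (solve (s ∷ P ∷ Q ∷ a ∷ []))
               (+-nonNeg (*-nonNeg (<⇒0≤-1 0<a) 0≤Q) (≤⇒0≤- P≤s)))
    0≤P′+s : 0ℤ ≤ a * Q - P + s
    0≤P′+s = ≤-trans 0≤Q Q≤P′+s
    -s≤P′ : - s ≤ a * Q - P
    -s≤P′ = 0≤-⇒≤ (nonNeg-≡ (a * Q - P + s) (solve (s ∷ P ∷ Q ∷ a ∷ [])) 0≤P′+s)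
    0<Q″ : 0ℤ < Q′ + + 2 * a * P - a * a * Q
    0<Q″ = 0<i*j⇒0<j 0≤Q (pos-≡ ((Q * Q′ + P * P - s * s) + (s * s - (a * Q - P) * (a * Q - P)))
             (solve (s ∷ P ∷ Q ∷ Q′ ∷ a ∷ []))
             (+-pos (<⇒0<- s²<D) (≤⇒0≤- (-j≤i≤j⇒i*i≤j*j -s≤P′ P′≤s))))
    Q″≤P′+s : Q′ + + 2 * a * P - a * a * Q ≤ a * Q - P + s
    Q″≤P′+s = i<j+1⇒i≤j (0<-⇒< (0<i*j⇒0<j 0≤Q (pos-≡
                (((s + 1ℤ) * (s + 1ℤ) - (Q * Q′ + P * P)) + ((1ℤ + a) * Q - (P + s) - 1ℤ) * (a * Q - P + s + 1ℤ))
                (solve (s ∷ P ∷ Q ∷ Q′ ∷ a ∷ []))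
                (+-pos (<⇒0<- D<[s+1]²) (*-nonNeg (<⇒0≤-1 P+s<[1+a]Q) (+-nonNeg 0≤P′+s (+≤+ z≤n)))))))
    s<P′+Q″ : s < (a * Q - P) + (Q′ + + 2 * a * P - a * a * Q)
    s<P′+Q″ = 0<-⇒< (0<i*j⇒0<j 0≤P′+s (pos-≡
                ((Q * Q′ + P * P - s * s) + (Q′ + + 2 * a * P - a * a * Q) * (a * Q - P + s - Q))
                (solve (s ∷ P ∷ Q ∷ Q′ ∷ a ∷ []))
                (+-pos (<⇒0<- s²<D) (*-nonNeg (<⇒≤ 0<Q″) (≤⇒0≤- Q≤P′+s)))))
    0<P′ : 0ℤ < a * Q - P
    0<P′ = 0<i*j⇒0<j {+ 2} (+≤+ z≤n) (pos-≡
             (((a * Q - P) + (Q′ + + 2 * a * P - a * a * Q) - s) + (a * Q - P + s - (Q′ + + 2 * a * P - a * a * Q)))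
             (solve (s ∷ P ∷ Q ∷ Q′ ∷ a ∷ []))
             (+-pos (<⇒0<- s<P′+Q″) (≤⇒0≤- Q″≤P′+s)))

module QuadraticIntegers where

  open IntegerOrder
  open import Data.Nat as ℕ using (ℕ; z≤n)
  open import Data.Integer
  open import Data.Integer.Properties using (<⇒≤; *-identityˡ; *-identityʳ; +-identityʳ; +-comm)
  open import Data.Integer.Tactic.RingSolver
  open import Data.Bool using (true; false)
  open import Data.List using ([]; _∷_)
  open import Data.Product using (_×_; _,_; proj₁; proj₂)
  open import Relation.Binary.PropositionalEquality

  infixr 7 _⊛_

  _⊛_ : ℤ → OK → OK
  τ ⊛ (x₁ , x₂) = (τ * x₁ , τ * x₂)

  ⊕-identityʳ : ∀ x → x ⊕ zeroK ≡ x
  ⊕-identityʳ (x₁ , x₂) = cong₂ _,_ (+-identityʳ x₁) (+-identityʳ x₂)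

  ⊕-comm : ∀ x y → x ⊕ y ≡ y ⊕ x
  ⊕-comm (x₁ , x₂) (y₁ , y₂) = cong₂ _,_ (+-comm x₁ y₁) (+-comm x₂ y₂)

  det : OK → OK → ℤ
  det (x₁ , x₂) (y₁ , y₂) = x₁ * y₂ - y₁ * x₂

  Q₀ : ℕ → ℤ
  Q₀ D = proj₂ (cfInit D)

  sqrtCoords-⊕ : ∀ D x y → sqrtCoords D (x ⊕ y) ≡ sqrtCoords D x ⊕ sqrtCoords D y
  sqrtCoords-⊕ D (x₁ , x₂) (y₁ , y₂) with oneMod4 D
  ... | true  = cong (_, x₂ + y₂) (identity x₁ x₂ y₁ y₂)
    where
    identity : ∀ x₁ x₂ y₁ y₂ → + 2 * (x₁ + y₁) + (x₂ + y₂) ≡ (+ 2 * x₁ + x₂) + (+ 2 * y₁ + y₂)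
    identity = solve-∀
  ... | false = refl

  sqrtCoords-⊛ : ∀ D τ x → sqrtCoords D (τ ⊛ x) ≡ τ ⊛ sqrtCoords D x
  sqrtCoords-⊛ D τ (x₁ , x₂) with oneMod4 D
  ... | true  = cong (_, τ * x₂) (identity τ x₁ x₂)
    where
    identity : ∀ τ x₁ x₂ → + 2 * (τ * x₁) + τ * x₂ ≡ τ * (+ 2 * x₁ + x₂)
    identity = solve-∀
  ... | false = refl

  det-sqrtCoords : ∀ D x y → det (sqrtCoords D x) (sqrtCoords D y) ≡ Q₀ D * det x y
  det-sqrtCoords D (x₁ , x₂) (y₁ , y₂) with oneMod4 D
  ... | true  = identity x₁ x₂ y₁ y₂
    where
    identity : ∀ x₁ x₂ y₁ y₂ → (+ 2 * x₁ + x₂) * y₂ - (+ 2 * y₁ + y₂) * x₂ ≡ + 2 * (x₁ * y₂ - y₁ * x₂)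
    identity = solve-∀
  ... | false = identity x₁ x₂ y₁ y₂
    where
    identity : ∀ x₁ x₂ y₁ y₂ → x₁ * y₂ - y₁ * x₂ ≡ + 1 * (x₁ * y₂ - y₁ * x₂)
    identity = solve-∀

  -- TotPos D x unfolds to InCone (+ D) (sqrtCoords D x).
  InCone : ℤ → ℤ × ℤ → Set
  InCone d (c , e) = (0ℤ < c) × (e * e * d < c * c)

  cone-⊕ : ∀ {d v w} → 0ℤ ≤ d → InCone d v → InCone d w → InCone d (v ⊕ w)
  cone-⊕ {d} {c₁ , e₁} {c₂ , e₂} 0≤d (0<c₁ , e₁²d<c₁²) (0<c₂ , e₂²d<c₂²) =
    +-pos 0<c₁ (<⇒≤ 0<c₂) ,
    0<-⇒< {(e₁ + e₂) * (e₁ + e₂) * d} {(c₁ + c₂) * (c₁ + c₂)} (pos-≡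
      ((c₁ * c₁ - e₁ * e₁ * d) + ((c₂ * c₂ - e₂ * e₂ * d) + + 2 * (c₁ * c₂ - e₁ * e₂ * d)))
      (solve (d ∷ c₁ ∷ e₁ ∷ c₂ ∷ e₂ ∷ []))
      (+-pos (<⇒0<- e₁²d<c₁²)
        (+-nonNeg (<⇒≤ (<⇒0<- e₂²d<c₂²)) (*-nonNeg {+ 2} (+≤+ z≤n) (<⇒≤ (<⇒0<- e₁e₂d<c₁c₂))))))
    where
    [e₁e₂d]²<[c₁c₂]² : (e₁ * e₂ * d) * (e₁ * e₂ * d) < (c₁ * c₂) * (c₁ * c₂)
    [e₁e₂d]²<[c₁c₂]² = 0<-⇒< (pos-≡
      ((c₁ * c₁ - e₁ * e₁ * d) * (c₂ * c₂) + (e₁ * e₁ * d) * (c₂ * c₂ - e₂ * e₂ * d))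
      (solve (d ∷ c₁ ∷ e₁ ∷ c₂ ∷ e₂ ∷ []))
      (+-pos (*-pos (<⇒0<- e₁²d<c₁²) (*-pos 0<c₂ 0<c₂))
        (*-nonNeg (*-nonNeg (0≤i*i e₁) 0≤d) (<⇒≤ (<⇒0<- e₂²d<c₂²)))))
    e₁e₂d<c₁c₂ : e₁ * e₂ * d < c₁ * c₂
    e₁e₂d<c₁c₂ = i*i<j*j⇒i<j (*-nonNeg (<⇒≤ 0<c₁) (<⇒≤ 0<c₂)) [e₁e₂d]²<[c₁c₂]²

  cone-det-pos : ∀ {d v c′ e′} → InCone d v → 0ℤ < e′ → c′ * c′ ≤ e′ * e′ * d → 0ℤ < det v (c′ , e′)
  cone-det-pos {d} {c , e} {c′} {e′} (0<c , e²d<c²) 0<e′ c′²≤e′²d =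
    <⇒0<- (i*i<j*j⇒i<j {c′ * e} {c * e′} (*-nonNeg (<⇒≤ 0<c) (<⇒≤ 0<e′)) (0<-⇒< (pos-≡
      ((c * c - e * e * d) * (e′ * e′) + (e * e) * (e′ * e′ * d - c′ * c′))
      (solve (d ∷ c ∷ e ∷ c′ ∷ e′ ∷ []))
      (+-pos (*-pos (<⇒0<- e²d<c²) (*-pos 0<e′ 0<e′)) (*-nonNeg (0≤i*i e) (≤⇒0≤- c′²≤e′²d))))))

  TotPos-⊕ : ∀ {D x y} → TotPos D x → TotPos D y → TotPos D (x ⊕ y)
  TotPos-⊕ {D} {x} {y} x≫0 y≫0 =
    subst (InCone (+ D)) (sym (sqrtCoords-⊕ D x y)) (cone-⊕ {v = sqrtCoords D x} {sqrtCoords D y} (+≤+ z≤n) x≫0 y≫0)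

  module UnimodularBasis (α α′ : OK) (det≡1 : det α α′ ≡ 1ℤ) where

    -- Coordinates in the basis (α, α′): x = S x · α + T x · α′.
    S T : OK → ℤ
    S x = det x α′
    T x = det α x

    g : ℤ → OK
    g τ = α ⊕ (τ ⊛ α′)

    S-⊕ : ∀ x y → S (x ⊕ y) ≡ S x + S y
    S-⊕ (x₁ , x₂) (y₁ , y₂) = identity x₁ x₂ y₁ y₂ (proj₁ α′) (proj₂ α′)
      where
      identity : ∀ x₁ x₂ y₁ y₂ a b → (x₁ + y₁) * b - a * (x₂ + y₂) ≡ (x₁ * b - a * x₂) + (y₁ * b - a * y₂)
      identity = solve-∀

    T-⊕ : ∀ x y → T (x ⊕ y) ≡ T x + T y
    T-⊕ (x₁ , x₂) (y₁ , y₂) = identity x₁ x₂ y₁ y₂ (proj₁ α) (proj₂ α)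
      where
      identity : ∀ x₁ x₂ y₁ y₂ a b → a * (x₂ + y₂) - (x₁ + y₁) * b ≡ (a * x₂ - x₁ * b) + (a * y₂ - y₁ * b)
      identity = solve-∀

    S-zero : S zeroK ≡ 0ℤ
    S-zero = identity (proj₁ α′) (proj₂ α′)
      where
      identity : ∀ a b → + 0 * b - a * + 0 ≡ 0ℤ
      identity = solve-∀

    S-g : ∀ τ → S (g τ) ≡ 1ℤ
    S-g τ = trans (identity τ (proj₁ α) (proj₂ α) (proj₁ α′) (proj₂ α′)) det≡1
      where
      identity : ∀ τ a b a′ b′ → (a + τ * a′) * b′ - a′ * (b + τ * b′) ≡ a * b′ - a′ * b
      identity = solve-∀

    T-g : ∀ τ → T (g τ) ≡ τ
    T-g τ = trans (identity τ (proj₁ α) (proj₂ α) (proj₁ α′) (proj₂ α′))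
                  (trans (cong (τ *_) det≡1) (*-identityʳ τ))
      where
      identity : ∀ τ a b a′ b′ → a * (b + τ * b′) - (a + τ * a′) * b ≡ τ * (a * b′ - a′ * b)
      identity = solve-∀

    g-injective : ∀ {τ σ} → g τ ≡ g σ → τ ≡ σ
    g-injective {τ} {σ} gτ≡gσ = trans (sym (T-g τ)) (trans (cong T gτ≡gσ) (T-g σ))

    g-⊕-shift : ∀ τ σ δ → g (τ - δ) ⊕ g (σ + δ) ≡ g τ ⊕ g σ
    g-⊕-shift τ σ δ = cong₂ _,_ (identity τ σ δ (proj₁ α) (proj₁ α′)) (identity τ σ δ (proj₂ α) (proj₂ α′))
      where
      identity : ∀ τ σ δ a a′ → (a + (τ - δ) * a′) + (a + (σ + δ) * a′) ≡ (a + τ * a′) + (a + σ * a′)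
      identity = solve-∀

    S≡1⇒≡g : ∀ x → S x ≡ 1ℤ → x ≡ g (T x)
    S≡1⇒≡g x@(x₁ , x₂) Sx≡1 = cong₂ _,_
      (coordinate x₁ a a′ (identity₁ x₁ x₂ a b a′ b′))
      (coordinate x₂ b b′ (identity₂ x₁ x₂ a b a′ b′))
      where
      open ≡-Reasoning
      a = proj₁ α
      b = proj₂ α
      a′ = proj₁ α′
      b′ = proj₂ α′
      identity₁ : ∀ x₁ x₂ a b a′ b′ →
                  x₁ * (a * b′ - a′ * b) ≡ (x₁ * b′ - a′ * x₂) * a + (a * x₂ - x₁ * b) * a′
      identity₁ = solve-∀
      identity₂ : ∀ x₁ x₂ a b a′ b′ →
                  x₂ * (a * b′ - a′ * b) ≡ (x₁ * b′ - a′ * x₂) * b + (a * x₂ - x₁ * b) * b′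
      identity₂ = solve-∀
      coordinate : ∀ z c c′ → z * det α α′ ≡ S x * c + T x * c′ → z ≡ c + T x * c′
      coordinate z c c′ z·det≡ = begin
        z                    ≡⟨ sym (*-identityʳ z) ⟩
        z * 1ℤ               ≡⟨ cong (z *_) (sym det≡1) ⟩
        z * det α α′         ≡⟨ z·det≡ ⟩
        S x * c + T x * c′   ≡⟨ cong (λ σ → σ * c + T x * c′) Sx≡1 ⟩
        1ℤ * c + T x * c′    ≡⟨ cong (_+ T x * c′) (*-identityˡ c) ⟩
        c + T x * c′         ∎

open QuadraticIntegers

module Partitions where

  open import Data.Nat as ℕ using (ℕ)
  import Data.Nat.Properties as ℕ
  import Data.Fin.Properties as Fin
  open import Data.Product using (proj₁; proj₂)
  open import Data.List.Relation.Binary.Permutation.Propositional using (↭-trans; ↭-sym; ↭-reflexive)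
  open import Function.Bundles using (_⇔_; mk⇔)
  open import Relation.Binary.PropositionalEquality

  open PartitionCount

  PartitionCount-≤ : ∀ {D α m n} → PartitionCount D α m → PartitionCount D α n → m ℕ.≤ n
  PartitionCount-≤ p q = Fin.injective⇒≤ {f = index} index-injective
    where
    index = λ k → proj₁ (complete q (reps p k) (isRep p k))
    index-injective : ∀ {k l} → index k ≡ index l → k ≡ l
    index-injective {k} {l} index-k≡index-l = distinct p k l
      (↭-trans (proj₂ (complete q (reps p k) (isRep p k)))
        (↭-trans (↭-reflexive (cong (reps q) index-k≡index-l)) (↭-sym (proj₂ (complete q (reps p l) (isRep p l))))))

  PartitionCount-unique : ∀ {D α m n} → PartitionCount D α m → PartitionCount D α n → m ≡ n
  PartitionCount-unique p q = ℕ.≤-antisym (PartitionCount-≤ p q) (PartitionCount-≤ q p)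

  PartitionCount⇔≡ : ∀ {D α n} → PartitionCount D α n → ∀ m → PartitionCount D α m ⇔ m ≡ n
  PartitionCount⇔≡ {D} {α} p m = mk⇔ (λ q → PartitionCount-unique q p) (λ m≡n → subst (PartitionCount D α) (sym m≡n) p)

module Counting {D : ℕ} (α α′ : OK) (det≡1 : det α α′ ≡ ℤ.1ℤ) (U : ℕ)
  (0<S : ∀ x → TotPos D x → ℤ.0ℤ ℤ.< UnimodularBasis.S α α′ det≡1 x)
  (TotPos-g⇔ : ∀ τ → TotPos D (UnimodularBasis.g α α′ det≡1 τ) ⇔ (ℤ.0ℤ ℤ.≤ τ × τ ℤ.≤ + U)) where

  open import Data.Nat using (zero; suc; _⊓_; _∸_)
  open import Data.Integer using (+≤+; 0ℤ; 1ℤ; -1ℤ; _+_; _*_; ∣_∣; _≤_; _<_)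

  open IntegerOrder
  import Data.Nat.Properties as ℕ
  open import Data.Integer.Properties
  open import Data.Integer.Tactic.RingSolver
  open import Data.Empty using (⊥-elim)
  open import Data.Fin as Fin using (Fin; toℕ; fromℕ<)
  import Data.Fin.Properties as Fin
  open import Data.List using (List; []; _∷_; length)
  open import Data.List.Relation.Unary.All using (All; []; _∷_)
  open import Data.List.Relation.Unary.Any using (here; there)
  open import Data.List.Relation.Binary.Permutation.Propositional using (_↭_; ↭-refl; ↭-reflexive; ↭-trans; swap)
  open import Data.List.Relation.Binary.Permutation.Propositional.Properties using (∈-resp-↭; ↭-length)
  open import Data.Product using (Σ; ∃-syntax; _,_; proj₁; proj₂)
  open import Data.Sum using (inj₁; inj₂)
  open import Function.Bundles using (Equivalence)
  open import Relation.Binary.PropositionalEquality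

  open UnimodularBasis α α′ det≡1

  length≤S-sum : ∀ xs → All (TotPos D) xs → + length xs ≤ S (sumK xs)
  length≤S-sum [] [] = ≤-reflexive (sym S-zero)
  length≤S-sum (x ∷ xs) (x≫0 ∷ xs≫0) =
    subst (+ length (x ∷ xs) ≤_) (sym (S-⊕ x (sumK xs))) (+-mono-≤ (i<j⇒suc[i]≤j (0<S x x≫0)) (length≤S-sum xs xs≫0))

  TotPos-g : ∀ {τ} → 0ℤ ≤ τ → τ ≤ + U → TotPos D (g τ)
  TotPos-g 0≤τ τ≤U = Equivalence.from (TotPos-g⇔ _) (0≤τ , τ≤U)

  module _ (r r′ : ℕ) (r≤r′ : r ℕ.≤ r′) (r′≤1+r : r′ ℕ.≤ suc r) (r′≤U : r′ ℕ.≤ U) where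

    c : ℕ
    c = r ⊓ (U ∸ r′)

    β : OK
    β = g (+ r) ⊕ g (+ r′)

    β≫0 : TotPos D β
    β≫0 = TotPos-⊕ {D} {g (+ r)} {g (+ r′)}
            (TotPos-g (+≤+ ℕ.z≤n) (+≤+ (ℕ.≤-trans r≤r′ r′≤U))) (TotPos-g (+≤+ ℕ.z≤n) (+≤+ r′≤U))

    S-β : S β ≡ + 2
    S-β = trans (S-⊕ (g (+ r)) (g (+ r′))) (cong₂ _+_ (S-g (+ r)) (S-g (+ r′)))

    T-β : T β ≡ + r + + r′
    T-β = trans (T-⊕ (g (+ r)) (g (+ r′))) (cong₂ _+_ (T-g (+ r)) (T-g (+ r′)))

    split : Fin (suc c) → List OK
    split l = g (+ r - + toℕ l) ∷ g (+ r′ + + toℕ l) ∷ []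

    reps : Fin (2 ℕ.+ c) → List OK
    reps Fin.zero    = β ∷ []
    reps (Fin.suc l) = split l

    isRep : ∀ i → IsRep D β (reps i)
    isRep Fin.zero    = _ , β≫0 ∷ [] , ⊕-identityʳ β
    isRep (Fin.suc l) = _ , TotPos-g 0≤r-l r-l≤U ∷ TotPos-g (+≤+ ℕ.z≤n) (+≤+ r′+l≤U) ∷ [] ,
      trans (cong (g (+ r - + toℕ l) ⊕_) (⊕-identityʳ _)) (g-⊕-shift (+ r) (+ r′) (+ toℕ l))
      where
      l≤c : toℕ l ℕ.≤ c
      l≤c = Fin.toℕ≤pred[n] l
      0≤r-l : 0ℤ ≤ + r - + toℕ l
      0≤r-l = ≤⇒0≤- (+≤+ (ℕ.≤-trans l≤c (ℕ.m⊓n≤m r (U ∸ r′))))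
      r-l≤U : + r - + toℕ l ≤ + U
      r-l≤U = ≤-trans (i-j≤i (+ r) (+ toℕ l)) (+≤+ (ℕ.≤-trans r≤r′ r′≤U))
      r′+l≤U : r′ ℕ.+ toℕ l ℕ.≤ U
      r′+l≤U = subst (ℕ._≤ U) (ℕ.+-comm (toℕ l) r′)
                 (ℕ.m≤o∸n⇒m+n≤o (toℕ l) r′≤U (ℕ.≤-trans l≤c (ℕ.m⊓n≤n r (U ∸ r′))))

    l′+l≡0 : ∀ {l l′} → + r - + l ≡ + r′ + + l′ → l′ ℕ.+ l ≡ 0
    l′+l≡0 {l} {l′} r-l≡r′+l′ = ℕ.n≤0⇒n≡0 (ℕ.+-cancelˡ-≤ r′ (l′ ℕ.+ l) 0 (begin
      r′ ℕ.+ (l′ ℕ.+ l)   ≡⟨ ℕ.+-assoc r′ l′ l ⟨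
      r′ ℕ.+ l′ ℕ.+ l     ≡⟨ +-injective {r} {r′ ℕ.+ l′ ℕ.+ l} (i-j≡k⇒i≡k+j {+ r} {+ l} r-l≡r′+l′) ⟨
      r                   ≤⟨ r≤r′ ⟩
      r′                  ≡⟨ ℕ.+-identityʳ r′ ⟨
      r′ ℕ.+ 0            ∎))
      where open ℕ.≤-Reasoning

    distinct : ∀ i i′ → reps i ↭ reps i′ → i ≡ i′
    distinct Fin.zero    Fin.zero     _ = refl
    distinct Fin.zero    (Fin.suc _)  p with ↭-length p
    ... | ()
    distinct (Fin.suc _) Fin.zero     p with ↭-length p
    ... | ()
    distinct (Fin.suc l) (Fin.suc l′) p with ∈-resp-↭ p (here refl)
    ... | here gr-l≡gr-l′ = cong Fin.suc (Fin.toℕ-injective (+-injective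
            (i-j≡i-k⇒j≡k {+ r} {+ toℕ l} (g-injective {+ r - + toℕ l} {+ r - + toℕ l′} gr-l≡gr-l′))))
    ... | there (here gr-l≡gr′+l′) = cong Fin.suc (Fin.toℕ-injective (trans l≡0 (sym l′≡0)))
      where
      l′+l≡0′ : toℕ l′ ℕ.+ toℕ l ≡ 0
      l′+l≡0′ = l′+l≡0 (g-injective {+ r - + toℕ l} {+ r′ + + toℕ l′} gr-l≡gr′+l′)
      l≡0 : toℕ l ≡ 0
      l≡0 = ℕ.m+n≡0⇒n≡0 (toℕ l′) l′+l≡0′
      l′≡0 : toℕ l′ ≡ 0
      l′≡0 = ℕ.m+n≡0⇒m≡0 (toℕ l′) l′+l≡0′
    ... | there (there ())

    larger-summand : ∀ {t t′} → t ≤ t′ → t + t′ ≡ + r + + r′ → + r′ ≤ t′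
    larger-summand {t} {t′} t≤t′ t+t′≡r+r′ = ≤-by-contradiction λ t′<r′ → -1≱0 (nonNeg-≡
      (+ 2 * (+ r′ - t′ - 1ℤ) + (t′ - t) + (1ℤ + + r - + r′)) certificate≡-1
      (+-nonNeg (+-nonNeg (*-nonNeg {+ 2} (+≤+ ℕ.z≤n) t′<r′) (≤⇒0≤- t≤t′)) (≤⇒0≤- (+≤+ r′≤1+r))))
      where
      open ≡-Reasoning
      identity₁ : ∀ t t′ R R′ → + 2 * (R′ - t′ - 1ℤ) + (t′ - t) + (1ℤ + R - R′) ≡ (R + R′) - (t + t′) - 1ℤ
      identity₁ = solve-∀
      identity₂ : ∀ x → x - x - 1ℤ ≡ -1ℤ
      identity₂ = solve-∀
      certificate≡-1 : + 2 * (+ r′ - t′ - 1ℤ) + (t′ - t) + (1ℤ + + r - + r′) ≡ -1ℤ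
      certificate≡-1 = begin
        + 2 * (+ r′ - t′ - 1ℤ) + (t′ - t) + (1ℤ + + r - + r′) ≡⟨ identity₁ t t′ (+ r) (+ r′) ⟩
        (+ r + + r′) - (t + t′) - 1ℤ                           ≡⟨ cong (λ z → (+ r + + r′) - z - 1ℤ) t+t′≡r+r′ ⟩
        (+ r + + r′) - (+ r + + r′) - 1ℤ                      ≡⟨ identity₂ (+ r + + r′) ⟩
        -1ℤ                                                   ∎

    offset : ∀ {t′} → + r′ ≤ t′ → t′ ≤ + r + + r′ → t′ ≤ + U →
             Σ (Fin (suc c)) λ l → t′ ≡ + r′ + + toℕ l
    offset {t′} r′≤t′ t′≤r+r′ t′≤U = fromℕ< (ℕ.s≤s n≤c) , (begin
      t′                                  ≡⟨ identity t′ (+ r′) ⟩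
      + r′ + (t′ - + r′)                  ≡⟨ cong (λ z → + r′ + z) (sym n≡t′-r′) ⟩
      + r′ + + n                          ≡⟨ cong (λ z → + r′ + + z) (sym (Fin.toℕ-fromℕ< (ℕ.s≤s n≤c))) ⟩
      + r′ + + toℕ (fromℕ< (ℕ.s≤s n≤c))   ∎)
      where
      open ≡-Reasoning
      identity : ∀ t′ R′ → t′ ≡ R′ + (t′ - R′)
      identity = solve-∀
      n : ℕ
      n = ∣ t′ - + r′ ∣
      n≡t′-r′ : + n ≡ t′ - + r′
      n≡t′-r′ = 0≤i⇒+∣i∣≡i (≤⇒0≤- r′≤t′)
      n+r′≡t′ : + n + + r′ ≡ t′
      n+r′≡t′ = trans (cong (_+ + r′) n≡t′-r′) (sym (trans (identity t′ (+ r′)) (+-comm (+ r′) (t′ - + r′))))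
      n≤c : n ℕ.≤ c
      n≤c = ℕ.⊓-glb (ℕ.+-cancelʳ-≤ r′ n r (drop‿+≤+ (subst (_≤ + r + + r′) (sym n+r′≡t′) t′≤r+r′)))
                    (ℕ.m+n≤o⇒m≤o∸n n (drop‿+≤+ (subst (_≤ + U) (sym n+r′≡t′) t′≤U)))

    ordered-pair : ∀ {x y} → TotPos D x → TotPos D y → x ⊕ y ≡ β → T x ≤ T y →
                   Σ (Fin (suc c)) λ l → x ∷ y ∷ [] ≡ split l
    ordered-pair {x} {y} x≫0 y≫0 x⊕y≡β Tx≤Ty =
      l , cong₂ (λ a b → a ∷ b ∷ []) (trans x≡gTx (cong g Tx≡r-l)) (trans y≡gTy (cong g Ty≡r′+l))
      where
      open ≡-Reasoning
      Sx+Sy≡2 : S x + S y ≡ + 2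
      Sx+Sy≡2 = trans (sym (S-⊕ x y)) (trans (cong S x⊕y≡β) S-β)
      Tx+Ty≡r+r′ : T x + T y ≡ + r + + r′
      Tx+Ty≡r+r′ = trans (sym (T-⊕ x y)) (trans (cong T x⊕y≡β) T-β)
      x≡gTx : x ≡ g (T x)
      x≡gTx = S≡1⇒≡g x (i+j≡2⇒i≡1 (0<S x x≫0) (0<S y y≫0) Sx+Sy≡2)
      y≡gTy : y ≡ g (T y)
      y≡gTy = S≡1⇒≡g y (i+j≡2⇒i≡1 (0<S y y≫0) (0<S x x≫0) (trans (+-comm (S y) (S x)) Sx+Sy≡2))
      bounds : ∀ {z} → z ≡ g (T z) → TotPos D z → 0ℤ ≤ T z × T z ≤ + U
      bounds {z} z≡g z≫0 = Equivalence.to (TotPos-g⇔ (T z)) (subst (TotPos D) z≡g z≫0)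
      identity₁ : ∀ t t′ → t ≡ (t + t′) - t′
      identity₁ = solve-∀
      Ty≤r+r′ : T y ≤ + r + + r′
      Ty≤r+r′ = subst (T y ≤_) Tx+Ty≡r+r′
                  (0≤-⇒≤ (nonNeg-≡ (T x) (identity₁ (T x) (T y)) (proj₁ (bounds x≡gTx x≫0))))
      located = offset (larger-summand Tx≤Ty Tx+Ty≡r+r′) Ty≤r+r′ (proj₂ (bounds y≡gTy y≫0))
      l = proj₁ located
      Ty≡r′+l = proj₂ located
      identity₂ : ∀ R R′ l → R + R′ - (R′ + l) ≡ R - l
      identity₂ = solve-∀
      Tx≡r-l : T x ≡ + r - + toℕ l
      Tx≡r-l = begin
        T x                          ≡⟨ i+j≡k⇒i≡k-j Tx+Ty≡r+r′ ⟩
        + r + + r′ - T y             ≡⟨ cong (λ z → + r + + r′ - z) Ty≡r′+l ⟩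
        + r + + r′ - (+ r′ + + toℕ l) ≡⟨ identity₂ (+ r) (+ r′) (+ toℕ l) ⟩
        + r - + toℕ l                ∎

    complete : ∀ xs → IsRep D β xs → ∃[ i ] (xs ↭ reps i)
    complete [] (() , _)
    complete (x ∷ []) (_ , _ , x⊕0≡β) = Fin.zero , ↭-reflexive (cong (_∷ []) (trans (sym (⊕-identityʳ x)) x⊕0≡β))
    complete (x ∷ y ∷ []) (_ , x≫0 ∷ y≫0 ∷ [] , x⊕y⊕0≡β) with ≤-total (T x) (T y)
    ... | inj₁ Tx≤Ty = let (l , xy≡split) = ordered-pair x≫0 y≫0 x⊕y≡β Tx≤Ty in
                       Fin.suc l , ↭-reflexive xy≡split
      where
      x⊕y≡β : x ⊕ y ≡ β
      x⊕y≡β = trans (cong (x ⊕_) (sym (⊕-identityʳ y))) x⊕y⊕0≡β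
    ... | inj₂ Ty≤Tx = let (l , yx≡split) = ordered-pair y≫0 x≫0 y⊕x≡β Ty≤Tx in
                       Fin.suc l , ↭-trans (swap x y ↭-refl) (↭-reflexive yx≡split)
      where
      y⊕x≡β : y ⊕ x ≡ β
      y⊕x≡β = trans (⊕-comm y x) (trans (cong (x ⊕_) (sym (⊕-identityʳ y))) x⊕y⊕0≡β)
    complete xs@(_ ∷ _ ∷ _ ∷ _) (_ , xs≫0 , Σxs≡β) =
      ⊥-elim (ℕ.≤⇒≯ (drop‿+≤+ length≤2) (ℕ.s≤s (ℕ.s≤s (ℕ.s≤s ℕ.z≤n))))
      where
      length≤2 : + length xs ≤ + 2
      length≤2 = subst (+ length xs ≤_) (trans (cong S Σxs≡β) S-β) (length≤S-sum xs xs≫0)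

    partitionCount : PartitionCount D β (2 ℕ.+ c)
    partitionCount = record { reps = reps ; isRep = isRep ; distinct = distinct ; complete = complete }

module ContinuedFraction (D : ℕ) (nonsquare : isqrt D ℕ.* isqrt D ℕ.< D) where

  open IntegerOrder
  open Floors
  open ReducedQuotients
  import Data.Nat.Properties as ℕ
  import Data.Nat.DivMod as ℕ
  open import Data.Integer
  open import Data.Integer.Properties using (pos-+; pos-*; +-comm; <⇒≤; i<j⇒suc[i]≤j; +-monoʳ-≤)
  open import Data.Integer.Tactic.RingSolver
  open import Data.Bool using (true; false; T; if_then_else_)
  open import Data.List using ([]; _∷_)
  open import Data.Product using (_×_; _,_; proj₁; proj₂; uncurry)
  open import Relation.Binary.PropositionalEquality
  open import Relation.Nullary using (contradiction)

  s : ℤ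
  s = + isqrt D

  P Q a : ℕ → ℤ
  P k = proj₁ (cfState D k)
  Q k = proj₂ (cfState D k)
  a = cfa D

  -- Q_{k-1}, so that D = Q_k Q_{k-1} + P_k²; for k = 0 this is (D - P₀²) / Q₀.
  Qprev : ℕ → ℤ
  Qprev ℕ.zero    = if oneMod4 D then + (2 ℕ.* (D ℕ./ 4)) else + D
  Qprev (ℕ.suc k) = Q k

  s²<D : s * s < + D
  s²<D = subst (_< + D) (pos-* (isqrt D) (isqrt D)) (+<+ nonsquare)

  D<[s+1]² : + D < (s + 1ℤ) * (s + 1ℤ)
  D<[s+1]² = subst (+ D <_) (trans (pos-* (ℕ.suc (isqrt D)) (ℕ.suc (isqrt D))) (cong (λ t → t * t) (+-comm 1ℤ s)))
               (+<+ (isqrt-sq> D))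

  0<s : 0ℤ < s
  0<s = 0<root (isqrt-sq> D)
    where
    0<root : ∀ {n} → D ℕ.< ℕ.suc n ℕ.* ℕ.suc n → 0ℤ < + n
    0<root {ℕ.zero}  D<1 = contradiction (ℕ.<-≤-trans (ℕ.≤-<-trans ℕ.z≤n nonsquare) (ℕ.≤-pred D<1)) λ ()
    0<root {ℕ.suc _} _   = +<+ (ℕ.s≤s ℕ.z≤n)

  reduced₀ : Reduced s (+ D) (P 0) (Q 0) (Qprev 0)
  reduced₀ with oneMod4 D in D%4≡1
  ... | true = record
    { 0<Q = +<+ (ℕ.s≤s ℕ.z≤n)
    ; P≤s = i<j⇒suc[i]≤j 0<s
    ; Q≤P+s = +-monoʳ-≤ 1ℤ (i<j⇒suc[i]≤j 0<s)
    ; D≡QQ′+P² = begin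
        + D                               ≡⟨ cong +_ D≡1+q*4 ⟩
        + (1 ℕ.+ q ℕ.* 4)                 ≡⟨ pos-+ 1 (q ℕ.* 4) ⟩
        1ℤ + + (q ℕ.* 4)                  ≡⟨ cong (λ t → 1ℤ + t) (pos-* q 4) ⟩
        1ℤ + + q * + 4                    ≡⟨ identity (+ q) ⟩
        + 2 * (+ 2 * + q) + + 1 * + 1     ≡⟨ cong (λ t → + 2 * t + + 1 * + 1) (sym (pos-* 2 q)) ⟩
        + 2 * + (2 ℕ.* q) + + 1 * + 1     ∎
    }
    where
    open ≡-Reasoning
    q = D ℕ./ 4
    D≡1+q*4 : D ≡ 1 ℕ.+ q ℕ.* 4
    D≡1+q*4 = trans (ℕ.m≡m%n+[m/n]*n D 4) (cong (ℕ._+ q ℕ.* 4) (ℕ.≡ᵇ⇒≡ (D ℕ.% 4) 1 (subst T (sym D%4≡1) _)))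
    identity : ∀ q → 1ℤ + q * + 4 ≡ + 2 * (+ 2 * q) + + 1 * + 1
    identity = solve-∀
  ... | false = record
    { 0<Q = +<+ (ℕ.s≤s ℕ.z≤n)
    ; P≤s = <⇒≤ 0<s
    ; Q≤P+s = i<j⇒suc[i]≤j 0<s
    ; D≡QQ′+P² = identity (+ D)
    }
    where
    identity : ∀ d → d ≡ + 1 * d + + 0 * + 0
    identity = solve-∀

  reduced   : ∀ k → Reduced s (+ D) (P k) (Q k) (Qprev k)
  a-floor   : ∀ k → a k * Q k ≤ P k + s × P k + s < (1ℤ + a k) * Q k
  reduction : ∀ k → Reduction s (+ D) (P k) (Q k) (Qprev k) (a k)
  Q-suc     : ∀ k → Q (ℕ.suc k) ≡ Qprev k + + 2 * a k * P k - a k * a k * Q k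

  reduced ℕ.zero    = reduced₀
  reduced (ℕ.suc k) = subst (λ q → Reduced s (+ D) (P (ℕ.suc k)) q (Q k)) (sym (Q-suc k))
                        (Reduction.reduced (reduction k))

  a-floor k = divPos-floor (P k + s) (Reduced.0<Q (reduced k))

  reduction k = uncurry (reduce s²<D D<[s+1]² (reduced k)) (a-floor k)

  Q-suc k = begin
    Q (ℕ.suc k)                    ≡⟨⟩
    divPos (+ D - P′ * P′) (Q k)   ≡⟨ cong (λ n → divPos n (Q k)) D-P′²≡QQ″ ⟩
    divPos (Q k * Q″) (Q k)        ≡⟨ divPos-exact Q″ (Reduced.0<Q (reduced k)) ⟩
    Q″                             ∎
    where
    open ≡-Reasoning
    P′ = P (ℕ.suc k)
    Q″ = Qprev k + + 2 * a k * P k - a k * a k * Q k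
    reduced′ : Reduced s (+ D) P′ Q″ (Q k)
    reduced′ = Reduction.reduced (reduction k)
    identity : ∀ d q q″ p′ → d ≡ q″ * q + p′ * p′ → d - p′ * p′ ≡ q * q″
    identity _ q q″ p′ refl = solve (q ∷ q″ ∷ p′ ∷ [])
    D-P′²≡QQ″ : + D - P′ * P′ ≡ Q k * Q″
    D-P′²≡QQ″ = identity (+ D) (Q k) Q″ P′ (Reduced.D≡QQ′+P² reduced′)

  0<Q : ∀ k → 0ℤ < Q k
  0<Q k = Reduced.0<Q (reduced k)

  0<a : ∀ k → 0ℤ < a k
  0<a k = Reduction.0<a (reduction k)

  0<P-suc : ∀ k → 0ℤ < P (ℕ.suc k)
  0<P-suc k = Reduction.0<P′ (reduction k)

  s<P+Q-suc : ∀ k → s < P (ℕ.suc k) + Q (ℕ.suc k)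
  s<P+Q-suc k = subst (λ q → s < P (ℕ.suc k) + q) (sym (Q-suc k)) (Reduction.s<P′+Q″ (reduction k))

module Convergents (D : ℕ) (nonsquare : isqrt D ℕ.* isqrt D ℕ.< D) where

  open import Data.Nat using (zero; suc)

  open IntegerOrder
  open ReducedQuotients
  open ContinuedFraction D nonsquare
  import Data.Nat.Properties as ℕ
  open import Data.Integer hiding (suc)
  open import Data.Integer.Properties using (<⇒≤; *-identityˡ; <-trans; ≤-<-trans; neg-involutive; 0≤i⇒+∣i∣≡i)
  open import Data.Integer.Tactic.RingSolver
  open import Data.Bool using (true; false)
  open import Data.List using ([]; _∷_)
  open import Data.Product using (_×_; _,_; proj₁; proj₂)
  open import Relation.Binary.PropositionalEquality
  open import Function.Bundles using (_⇔_; mk⇔)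

  α : ℕ → OK
  α = alphaS D

  v : ℕ → ℤ × ℤ
  v j = sqrtCoords D (α j)

  C E : ℕ → ℤ
  C j = proj₁ (v j)
  E j = proj₂ (v j)

  α-rec : ∀ j → α (suc (suc j)) ≡ (a (suc j) ⊛ α (suc j)) ⊕ α j
  α-rec j = cong₂ _,_
    (identity₁ (a (suc j)) (proj₁ (pq D (suc j))) (proj₂ (pq D (suc j))) (proj₁ (pq D j)) (proj₂ (pq D j)) (proj₁ (ξ D)))
    (identity₂ (a (suc j)) (proj₂ (pq D (suc j))) (proj₂ (pq D j)) (proj₂ (ξ D)))
    where
    identity₁ : ∀ c p₁ q₁ p₀ q₀ x → (c * p₁ + p₀) + (c * q₁ + q₀) * x ≡ c * (p₁ + q₁ * x) + (p₀ + q₀ * x)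
    identity₁ = solve-∀
    identity₂ : ∀ c q₁ q₀ y → + 0 + (c * q₁ + q₀) * y ≡ c * (+ 0 + q₁ * y) + (+ 0 + q₀ * y)
    identity₂ = solve-∀

  v-rec : ∀ j → v (suc (suc j)) ≡ (a (suc j) ⊛ v (suc j)) ⊕ v j
  v-rec j = begin
    sqrtCoords D (α (suc (suc j)))                 ≡⟨ cong (sqrtCoords D) (α-rec j) ⟩
    sqrtCoords D ((a (suc j) ⊛ α (suc j)) ⊕ α j)   ≡⟨ sqrtCoords-⊕ D _ (α j) ⟩
    sqrtCoords D (a (suc j) ⊛ α (suc j)) ⊕ v j     ≡⟨ cong (_⊕ v j) (sqrtCoords-⊛ D (a (suc j)) (α (suc j))) ⟩
    (a (suc j) ⊛ v (suc j)) ⊕ v j                   ∎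
    where open ≡-Reasoning

  v₀ : v 0 ≡ (Q 0 , 0ℤ)
  v₀ with oneMod4 D
  ... | true  = refl
  ... | false = refl

  v₁ : v 1 ≡ (P 1 , 1ℤ)
  v₁ with oneMod4 D
  ... | true  = cong (_, 1ℤ) (identity (divPos (+ 1 + s) (+ 2)))
    where
    identity : ∀ x → + 2 * (x + + 1 * - + 1) + (+ 0 + + 1 * + 1) ≡ x * + 2 - + 1
    identity = solve-∀
  ... | false = cong (_, 1ℤ) (identity (divPos (+ 0 + s) (+ 1)))
    where
    identity : ∀ x → x + + 1 * + 0 ≡ x * + 1 - + 0
    identity = solve-∀

  -- ⟪ sqrtCoords D x , sqrtCoords D x ⟫ = Q₀² · N(x).
  ⟪_,_⟫ : ℤ × ℤ → ℤ × ℤ → ℤ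
  ⟪ (c , e) , (c′ , e′) ⟫ = c * c′ - e * e′ * + D

  ⟪⟫-expand : ∀ k x y →
              ⟪ (k ⊛ x) ⊕ y , (k ⊛ x) ⊕ y ⟫ ≡ k * k * ⟪ x , x ⟫ + + 2 * k * ⟪ x , y ⟫ + ⟪ y , y ⟫
  ⟪⟫-expand k (c , e) (c′ , e′) = identity (+ D) k c e c′ e′
    where
    identity : ∀ d k c e c′ e′ → (k * c + c′) * (k * c + c′) - (k * e + e′) * (k * e + e′) * d
                                 ≡ k * k * (c * c - e * e * d) + + 2 * k * (c * c′ - e * e′ * d) + (c′ * c′ - e′ * e′ * d)
    identity = solve-∀

  ⟪⟫-expandˡ : ∀ k x y → ⟪ (k ⊛ x) ⊕ y , x ⟫ ≡ k * ⟪ x , x ⟫ + ⟪ x , y ⟫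
  ⟪⟫-expandˡ k (c , e) (c′ , e′) = identity (+ D) k c e c′ e′
    where
    identity : ∀ d k c e c′ e′ →
               (k * c + c′) * c - (k * e + e′) * e * d ≡ k * (c * c - e * e * d) + (c * c′ - e * e′ * d)
    identity = solve-∀

  ⟪⟫-expandʳ : ∀ τ x y →
               ⟪ x ⊕ (τ ⊛ y) , x ⊕ (τ ⊛ y) ⟫ ≡ ⟪ x , x ⟫ + + 2 * τ * ⟪ y , x ⟫ + τ * τ * ⟪ y , y ⟫
  ⟪⟫-expandʳ τ (c , e) (c′ , e′) = identity (+ D) τ c e c′ e′
    where
    identity : ∀ d τ c e c′ e′ → (c + τ * c′) * (c + τ * c′) - (e + τ * e′) * (e + τ * e′) * d
                                 ≡ (c * c - e * e * d) + + 2 * τ * (c′ * c - e′ * e * d) + τ * τ * (c′ * c′ - e′ * e′ * d)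
    identity = solve-∀

  norm-v : ∀ j → ⟪ v j , v j ⟫ ≡ -1ℤ ^ j * Q 0 * Q j
               × ⟪ v (suc j) , v (suc j) ⟫ ≡ -1ℤ ^ suc j * Q 0 * Q (suc j)
               × ⟪ v (suc j) , v j ⟫ ≡ -1ℤ ^ j * Q 0 * P (suc j)
  norm-v zero rewrite v₀ | v₁ =
      identity₀ (+ D) (Q 0)
    , identity₁ (P 1) (Q 0) (Q 1) (+ D) (Reduced.D≡QQ′+P² (reduced 1))
    , identity₂ (P 1) (Q 0) (+ D)
    where
    identity₀ : ∀ d q → q * q - 0ℤ * 0ℤ * d ≡ 1ℤ * q * q
    identity₀ = solve-∀
    identity₁ : ∀ p q₀ q₁ d → d ≡ q₁ * q₀ + p * p → p * p - 1ℤ * 1ℤ * d ≡ -1ℤ * 1ℤ * q₀ * q₁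
    identity₁ p q₀ q₁ _ refl = solve (p ∷ q₀ ∷ q₁ ∷ [])
    identity₂ : ∀ p q d → p * q - 1ℤ * 0ℤ * d ≡ 1ℤ * q * p
    identity₂ = solve-∀
  norm-v (suc j) with norm-v j
  ... | nⱼ , nⱼ₊₁ , mⱼ = nⱼ₊₁ , nⱼ₊₂ , mⱼ₊₁
    where
    open ≡-Reasoning
    c = a (suc j)
    g = -1ℤ ^ j
    nⱼ₊₂ : ⟪ v (suc (suc j)) , v (suc (suc j)) ⟫ ≡ -1ℤ ^ suc (suc j) * Q 0 * Q (suc (suc j))
    nⱼ₊₂ = begin
      ⟪ v (suc (suc j)) , v (suc (suc j)) ⟫
        ≡⟨ cong (λ x → ⟪ x , x ⟫) (v-rec j) ⟩
      ⟪ (c ⊛ v (suc j)) ⊕ v j , (c ⊛ v (suc j)) ⊕ v j ⟫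
        ≡⟨ ⟪⟫-expand c (v (suc j)) (v j) ⟩
      c * c * ⟪ v (suc j) , v (suc j) ⟫ + + 2 * c * ⟪ v (suc j) , v j ⟫ + ⟪ v j , v j ⟫
        ≡⟨ cong₂ (λ x y → c * c * x + + 2 * c * y + ⟪ v j , v j ⟫) nⱼ₊₁ mⱼ ⟩
      c * c * (-1ℤ * g * Q 0 * Q (suc j)) + + 2 * c * (g * Q 0 * P (suc j)) + ⟪ v j , v j ⟫
        ≡⟨ cong (λ x → c * c * (-1ℤ * g * Q 0 * Q (suc j)) + + 2 * c * (g * Q 0 * P (suc j)) + x) nⱼ ⟩
      c * c * (-1ℤ * g * Q 0 * Q (suc j)) + + 2 * c * (g * Q 0 * P (suc j)) + g * Q 0 * Q j
        ≡⟨ identity g (Q 0) c (Q j) (P (suc j)) (Q (suc j)) ⟩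
      -1ℤ * (-1ℤ * g) * Q 0 * (Q j + + 2 * c * P (suc j) - c * c * Q (suc j))
        ≡⟨ cong (-1ℤ * (-1ℤ * g) * Q 0 *_) (sym (Q-suc (suc j))) ⟩
      -1ℤ * (-1ℤ * g) * Q 0 * Q (suc (suc j)) ∎
      where
      identity : ∀ g q₀ c q p q′ → c * c * (-1ℤ * g * q₀ * q′) + + 2 * c * (g * q₀ * p) + g * q₀ * q
                                   ≡ -1ℤ * (-1ℤ * g) * q₀ * (q + + 2 * c * p - c * c * q′)
      identity = solve-∀
    mⱼ₊₁ : ⟪ v (suc (suc j)) , v (suc j) ⟫ ≡ -1ℤ ^ suc j * Q 0 * P (suc (suc j))
    mⱼ₊₁ = begin
      ⟪ v (suc (suc j)) , v (suc j) ⟫                     ≡⟨ cong ⟪_, v (suc j) ⟫ (v-rec j) ⟩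
      ⟪ (c ⊛ v (suc j)) ⊕ v j , v (suc j) ⟫               ≡⟨ ⟪⟫-expandˡ c (v (suc j)) (v j) ⟩
      c * ⟪ v (suc j) , v (suc j) ⟫ + ⟪ v (suc j) , v j ⟫ ≡⟨ cong₂ (λ x y → c * x + y) nⱼ₊₁ mⱼ ⟩
      c * (-1ℤ * g * Q 0 * Q (suc j)) + g * Q 0 * P (suc j) ≡⟨ identity g (Q 0) c (Q (suc j)) (P (suc j)) ⟩
      -1ℤ * g * Q 0 * (c * Q (suc j) - P (suc j))         ∎
      where
      identity : ∀ g q₀ c q p → c * (-1ℤ * g * q₀ * q) + g * q₀ * p ≡ -1ℤ * g * q₀ * (c * q - p)
      identity = solve-∀

  det-α : ∀ j → det (α j) (α (suc j)) ≡ -1ℤ ^ j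
  det-α zero = trans (identity (proj₁ (ξ D)) (proj₂ (ξ D)) (a 0)) ξ₂≡1
    where
    identity : ∀ x y a₀ → (+ 1 + + 0 * x) * (+ 0 + + 1 * y) - (a₀ + + 1 * x) * (+ 0 + + 0 * y) ≡ y
    identity = solve-∀
    ξ₂≡1 : proj₂ (ξ D) ≡ 1ℤ
    ξ₂≡1 with oneMod4 D
    ... | true  = refl
    ... | false = refl
  det-α (suc j) = begin
    det (α (suc j)) (α (suc (suc j)))                    ≡⟨ cong (det (α (suc j))) (α-rec j) ⟩
    det (α (suc j)) ((a (suc j) ⊛ α (suc j)) ⊕ α j)      ≡⟨ det-swap (a (suc j)) (α (suc j)) (α j) ⟩
    -1ℤ * det (α j) (α (suc j))                          ≡⟨ cong (-1ℤ *_) (det-α j) ⟩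
    -1ℤ * -1ℤ ^ j                                        ∎
    where
    open ≡-Reasoning
    det-swap : ∀ k x y → det x ((k ⊛ x) ⊕ y) ≡ -1ℤ * det y x
    det-swap k (x₁ , x₂) (y₁ , y₂) = identity k x₁ x₂ y₁ y₂
      where
      identity : ∀ k x₁ x₂ y₁ y₂ → x₁ * (k * x₂ + y₂) - (k * x₁ + y₁) * x₂ ≡ -1ℤ * (y₁ * x₂ - x₁ * y₂)
      identity = solve-∀

  0<C : ∀ j → 0ℤ < C j × 0ℤ < C (suc j)
  0<C zero = subst (0ℤ <_) (sym (cong proj₁ v₀)) (0<Q 0) , subst (0ℤ <_) (sym (cong proj₁ v₁)) (0<P-suc 0)
  0<C (suc j) with 0<C j
  ... | 0<Cⱼ , 0<Cⱼ₊₁ =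
    0<Cⱼ₊₁ , subst (0ℤ <_) (sym (cong proj₁ (v-rec j))) (+-pos (*-pos (0<a (suc j)) 0<Cⱼ₊₁) (<⇒≤ 0<Cⱼ))

  0<E : ∀ j → 0ℤ ≤ E j × 0ℤ < E (suc j)
  0<E zero =
    subst (0ℤ ≤_) (sym (cong proj₂ v₀)) (+≤+ ℕ.z≤n) , subst (0ℤ <_) (sym (cong proj₂ v₁)) (+<+ (ℕ.s≤s ℕ.z≤n))
  0<E (suc j) with 0<E j
  ... | 0≤Eⱼ , 0<Eⱼ₊₁ =
    <⇒≤ 0<Eⱼ₊₁ , subst (0ℤ <_) (sym (cong proj₂ (v-rec j))) (+-pos (*-pos (0<a (suc j)) 0<Eⱼ₊₁) 0≤Eⱼ)

  -1^even : ∀ k → -1ℤ ^ (2 ℕ.* k) ≡ 1ℤ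
  -1^even zero    = refl
  -1^even (suc k) = begin
    -1ℤ ^ (2 ℕ.* suc k)           ≡⟨ cong (-1ℤ ^_) (ℕ.*-suc 2 k) ⟩
    -1ℤ * (-1ℤ * -1ℤ ^ (2 ℕ.* k)) ≡⟨ cong (λ x → -1ℤ * (-1ℤ * x)) (-1^even k) ⟩
    1ℤ                            ∎
    where open ≡-Reasoning

  module Even (k : ℕ) where

    j : ℕ
    j = 2 ℕ.* k

    p q U : ℤ
    p = P (suc j)
    q = Q (suc j)
    U = a (suc j)

    open UnimodularBasis (α j) (α (suc j)) (trans (det-α j) (-1^even k)) public

    v-g : ∀ τ → sqrtCoords D (g τ) ≡ v j ⊕ (τ ⊛ v (suc j))
    v-g τ = trans (sqrtCoords-⊕ D (α j) (τ ⊛ α (suc j))) (cong (v j ⊕_) (sqrtCoords-⊛ D τ (α (suc j))))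

    even-sign : ∀ x y → -1ℤ ^ j * x * y ≡ x * y
    even-sign x y = trans (cong (λ g → g * x * y) (-1^even k)) (cong (_* y) (*-identityˡ x))

    ⟪vⱼ,vⱼ⟫ : ⟪ v j , v j ⟫ ≡ Q 0 * Q j
    ⟪vⱼ,vⱼ⟫ = trans (proj₁ (norm-v j)) (even-sign (Q 0) (Q j))

    ⟪vⱼ₊₁,vⱼ⟫ : ⟪ v (suc j) , v j ⟫ ≡ Q 0 * p
    ⟪vⱼ₊₁,vⱼ⟫ = trans (proj₂ (proj₂ (norm-v j))) (even-sign (Q 0) p)

    ⟪vⱼ₊₁,vⱼ₊₁⟫ : ⟪ v (suc j) , v (suc j) ⟫ ≡ - (Q 0 * q)
    ⟪vⱼ₊₁,vⱼ₊₁⟫ = trans (proj₁ (proj₂ (norm-v j)))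
                    (trans (cong (λ g → -1ℤ * g * Q 0 * q) (-1^even k)) (identity (Q 0) q))
      where
      identity : ∀ x y → -1ℤ * 1ℤ * x * y ≡ - (x * y)
      identity = solve-∀

    norm-g : ∀ τ → ⟪ sqrtCoords D (g τ) , sqrtCoords D (g τ) ⟫ ≡ Q 0 * (Q j + + 2 * τ * p - τ * τ * q)
    norm-g τ = begin
      ⟪ sqrtCoords D (g τ) , sqrtCoords D (g τ) ⟫
        ≡⟨ cong (λ x → ⟪ x , x ⟫) (v-g τ) ⟩
      ⟪ v j ⊕ (τ ⊛ v (suc j)) , v j ⊕ (τ ⊛ v (suc j)) ⟫
        ≡⟨ ⟪⟫-expandʳ τ (v j) (v (suc j)) ⟩
      ⟪ v j , v j ⟫ + + 2 * τ * ⟪ v (suc j) , v j ⟫ + τ * τ * ⟪ v (suc j) , v (suc j) ⟫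
        ≡⟨ cong₂ (λ x y → x + + 2 * τ * y + τ * τ * ⟪ v (suc j) , v (suc j) ⟫) ⟪vⱼ,vⱼ⟫ ⟪vⱼ₊₁,vⱼ⟫ ⟩
      Q 0 * Q j + + 2 * τ * (Q 0 * p) + τ * τ * ⟪ v (suc j) , v (suc j) ⟫
        ≡⟨ cong (λ z → Q 0 * Q j + + 2 * τ * (Q 0 * p) + τ * τ * z) ⟪vⱼ₊₁,vⱼ₊₁⟫ ⟩
      Q 0 * Q j + + 2 * τ * (Q 0 * p) + τ * τ * - (Q 0 * q)
        ≡⟨ identity (Q 0) (Q j) p q τ ⟩
      Q 0 * (Q j + + 2 * τ * p - τ * τ * q) ∎
      where
      open ≡-Reasoning
      identity : ∀ q₀ q′ p q τ →
                 q₀ * q′ + + 2 * τ * (q₀ * p) + τ * τ * - (q₀ * q) ≡ q₀ * (q′ + + 2 * τ * p - τ * τ * q)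
      identity = solve-∀

    q*form≡D-square : ∀ τ → q * (Q j + + 2 * τ * p - τ * τ * q) ≡ + D - (τ * q - p) * (τ * q - p)
    q*form≡D-square τ = identity (+ D) q (Q j) p τ (Reduced.D≡QQ′+P² (reduced (suc j)))
      where
      identity : ∀ d q q′ p τ → d ≡ q * q′ + p * p →
                 q * (q′ + + 2 * τ * p - τ * τ * q) ≡ d - (τ * q - p) * (τ * q - p)
      identity _ q q′ p τ refl = solve (q ∷ q′ ∷ p ∷ τ ∷ [])

    TotPos-g⇔ : ∀ τ → TotPos D (g τ) ⇔ (0ℤ ≤ τ × τ ≤ U)
    TotPos-g⇔ τ = mk⇔ bounds totPos
      where
      0<q : 0ℤ < q
      0<q = 0<Q (suc j)
      Uq≤p+s : U * q ≤ p + s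
      Uq≤p+s = proj₁ (a-floor (suc j))
      p+s<[1+U]q : p + s < (1ℤ + U) * q
      p+s<[1+U]q = proj₂ (a-floor (suc j))
      w = τ * q - p

      bounds : TotPos D (g τ) → 0ℤ ≤ τ × τ ≤ U
      bounds (_ , e²D<c²) = i<j+1⇒i≤j 0<τ+1 , i<j+1⇒i≤j (0<-⇒< 0<U+1-τ)
        where
        0<form : 0ℤ < Q j + + 2 * τ * p - τ * τ * q
        0<form = 0<i*j⇒0<j (<⇒≤ (0<Q 0)) (subst (0ℤ <_) (norm-g τ) (<⇒0<- e²D<c²))
        w²<D : w * w < + D
        w²<D = 0<-⇒< {w * w} (subst (0ℤ <_) (q*form≡D-square τ) (*-pos 0<q 0<form))
        -s≤w≤s : - s ≤ w × w ≤ s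
        -s≤w≤s = i*i<[j+1]²⇒-j≤i≤j (<⇒≤ 0<s) (<-trans w²<D D<[s+1]²)
        0<τ+1 : 0ℤ < τ + 1ℤ
        0<τ+1 = 0<i*j⇒0<j (<⇒≤ 0<q) (pos-≡ ((p + q - s) + (w - - s)) (identity₁ τ q p s)
                  (+-pos (<⇒0<- (s<P+Q-suc j)) (≤⇒0≤- (proj₁ -s≤w≤s))))
          where
          identity₁ : ∀ τ q p s → (p + q - s) + ((τ * q - p) - - s) ≡ q * (τ + 1ℤ)
          identity₁ = solve-∀
        0<U+1-τ : 0ℤ < U + 1ℤ - τ
        0<U+1-τ = 0<i*j⇒0<j (<⇒≤ 0<q) (pos-≡ (((1ℤ + U) * q - (p + s)) + (s - w)) (identity₂ τ q p s U)
                    (+-pos (<⇒0<- p+s<[1+U]q) (≤⇒0≤- (proj₂ -s≤w≤s))))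
          where
          identity₂ : ∀ τ q p s U → ((1ℤ + U) * q - (p + s)) + (s - (τ * q - p)) ≡ q * (U + 1ℤ - τ)
          identity₂ = solve-∀

      totPos : 0ℤ ≤ τ × τ ≤ U → TotPos D (g τ)
      totPos (0≤τ , τ≤U) =
        subst (0ℤ <_) (sym (cong proj₁ (v-g τ))) (+-pos (proj₁ (0<C j)) (*-nonNeg 0≤τ (<⇒≤ (proj₂ (0<C j))))) ,
        0<-⇒< {proj₂ (sqrtCoords D (g τ)) * proj₂ (sqrtCoords D (g τ)) * + D}
              (subst (0ℤ <_) (sym (norm-g τ)) (*-pos (0<Q 0) 0<form))
        where
        -s≤w : - s ≤ w
        -s≤w = 0≤-⇒≤ (nonNeg-≡ (τ * q + (s - p)) (identity₁ τ q p s)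
                 (+-nonNeg (*-nonNeg 0≤τ (<⇒≤ 0<q)) (≤⇒0≤- (Reduced.P≤s (reduced (suc j))))))
          where
          identity₁ : ∀ τ q p s → τ * q + (s - p) ≡ (τ * q - p) - - s
          identity₁ = solve-∀
        w≤s : w ≤ s
        w≤s = 0≤-⇒≤ (nonNeg-≡ ((U - τ) * q + (p + s - U * q)) (identity₂ τ q p s U)
                (+-nonNeg (*-nonNeg (≤⇒0≤- τ≤U) (<⇒≤ 0<q)) (≤⇒0≤- Uq≤p+s)))
          where
          identity₂ : ∀ τ q p s U → (U - τ) * q + (p + s - U * q) ≡ s - (τ * q - p)
          identity₂ = solve-∀
        0<form : 0ℤ < Q j + + 2 * τ * p - τ * τ * q
        0<form = 0<i*j⇒0<j (<⇒≤ 0<q) (subst (0ℤ <_) (sym (q*form≡D-square τ))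
                   (<⇒0<- {w * w} (≤-<-trans (-j≤i≤j⇒i*i≤j*j -s≤w w≤s) s²<D)))

    0<S : ∀ x → TotPos D x → 0ℤ < S x
    0<S x x≫0 = 0<i*j⇒0<j (<⇒≤ (0<Q 0)) (subst (0ℤ <_) (det-sqrtCoords D x (α (suc j)))
                  (cone-det-pos {v = sqrtCoords D x} {C (suc j)} {E (suc j)} x≫0 (proj₂ (0<E j)) C²≤E²D))
      where
      C²≤E²D : C (suc j) * C (suc j) ≤ E (suc j) * E (suc j) * + D
      C²≤E²D = 0≤-⇒≤ (nonNeg-≡ (Q 0 * q)
                 (flip-sign {C (suc j) * C (suc j)} {E (suc j) * E (suc j) * + D} ⟪vⱼ₊₁,vⱼ₊₁⟫)
                 (*-nonNeg (<⇒≤ (0<Q 0)) (<⇒≤ (0<Q (suc j)))))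
        where
        flip-sign : ∀ {x y z} → x - y ≡ - z → z ≡ y - x
        flip-sign {x} {y} {z} x-y≡-z = begin
          z           ≡⟨ sym (neg-involutive z) ⟩
          - - z       ≡⟨ cong -_ (sym x-y≡-z) ⟩
          - (x - y)   ≡⟨ identity x y ⟩
          y - x       ∎
          where
          open ≡-Reasoning
          identity : ∀ x y → - (x - y) ≡ y - x
          identity = solve-∀

    ∣U∣ : ℕ
    ∣U∣ = ∣ U ∣

    u≡∣U∣ : u D (2 ℕ.* k ℕ.+ 1) ≡ + ∣U∣
    u≡∣U∣ = trans (cong (cfa D) (ℕ.+-comm (2 ℕ.* k) 1)) (sym (0≤i⇒+∣i∣≡i (<⇒≤ (0<a (suc j)))))

    TotPos-g⇔∣U∣ : ∀ τ → TotPos D (g τ) ⇔ (0ℤ ≤ τ × τ ≤ + ∣U∣)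
    TotPos-g⇔∣U∣ τ = subst (λ V → TotPos D (g τ) ⇔ (0ℤ ≤ τ × τ ≤ V))
                      (sym (0≤i⇒+∣i∣≡i (<⇒≤ (0<a (suc j))))) (TotPos-g⇔ τ)

    open Counting {D} (α j) (α (suc j)) (trans (det-α j) (-1^even k)) ∣U∣ 0<S TotPos-g⇔∣U∣ using (partitionCount)

    partitionCount-double : ∀ r → r ℕ.< ∣U∣ → PartitionCount D (2 ⊙ alphaSR D j r) (2 ℕ.+ r ℕ.⊓ (∣U∣ ℕ.∸ r))
    partitionCount-double r r<U = subst (λ β → PartitionCount D β (2 ℕ.+ r ℕ.⊓ (∣U∣ ℕ.∸ r))) (sym 2αᵣ≡gr⊕gr)
      (partitionCount r r ℕ.≤-refl (ℕ.n≤1+n r) (ℕ.<⇒≤ r<U))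
      where
      identity : ∀ r x y → + 2 * (x + r * y) ≡ (x + r * y) + (x + r * y)
      identity = solve-∀
      2αᵣ≡gr⊕gr : 2 ⊙ alphaSR D j r ≡ g (+ r) ⊕ g (+ r)
      2αᵣ≡gr⊕gr = cong₂ _,_ (identity (+ r) (proj₁ (α j)) (proj₁ (α (suc j))))
                            (identity (+ r) (proj₂ (α j)) (proj₂ (α (suc j))))

    partitionCount-consecutive : ∀ r → r ℕ.< ∣U∣ →
      PartitionCount D (alphaSR D j r ⊕ alphaSR D j (suc r)) (2 ℕ.+ r ℕ.⊓ (∣U∣ ℕ.∸ suc r))
    partitionCount-consecutive r r<U = partitionCount r (suc r) (ℕ.n≤1+n r) ℕ.≤-refl r<U

module Conditions where

  open IntegerOrder
  open import Data.Nat as ℕ using (ℕ; _∸_)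
  import Data.Nat.Properties as ℕ
  open import Data.Integer
  open import Data.Integer.Properties
  open import Data.Integer.Tactic.RingSolver
  open import Data.Empty using (⊥-elim)
  open import Data.List using ([]; _∷_)
  open import Data.Product using (_×_; _,_)
  open import Data.Sum using (_⊎_; inj₁; inj₂)
  open import Function.Bundles using (_⇔_; mk⇔)
  import Function.Properties.Equivalence as ⇔
  open import Relation.Binary.PropositionalEquality
  open import Relation.Nullary using (yes; no)

  DoubleCondition : ℤ → ℤ → ℤ → ℤ → Set
  DoubleCondition R M 2M V = (R ≡ M - + 2 × 2M - + 4 ≤ V) ⊎ (R ≡ V - (M - + 2) × 2M - + 3 ≤ V)

  ConsecutiveCondition : ℤ → ℤ → ℤ → ℤ → Set
  ConsecutiveCondition R M 2M V = (R ≡ M - + 2 × 2M - + 3 ≤ V) ⊎ (R ≡ V - (M - + 1) × 2M - + 2 ≤ V)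

  double-count⇔ : ∀ {R M 2M V C} → 2M ≡ M + M →
                  (C ≡ R + + 2 × R + R ≤ V) ⊎ (C ≡ V - R + + 2 × V < R + R) →
                  M ≡ C ⇔ DoubleCondition R M 2M V
  double-count⇔ {R} {M} {_} {V} refl (inj₁ (refl , 2R≤V)) = mk⇔ to from
    where
    to : M ≡ R + + 2 → DoubleCondition R M (M + M) V
    to refl = inj₁ (solve (R ∷ []) , 0≤-⇒≤ (nonNeg-≡ (V - (R + R)) (solve (R ∷ V ∷ [])) (≤⇒0≤- 2R≤V)))
    from : DoubleCondition R M (M + M) V → M ≡ R + + 2
    from (inj₁ (refl , _)) = solve (M ∷ [])
    from (inj₂ (refl , 2M-3≤V)) = ⊥-elim (-1≱0 (nonNeg-≡ ((V - (R + R)) + (V - (M + M - + 3))) (solve (M ∷ V ∷ []))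
      (+-nonNeg (≤⇒0≤- 2R≤V) (≤⇒0≤- 2M-3≤V))))
  double-count⇔ {R} {M} {_} {V} refl (inj₂ (refl , V<2R)) = mk⇔ to from
    where
    to : M ≡ V - R + + 2 → DoubleCondition R M (M + M) V
    to refl = inj₂ (solve (R ∷ V ∷ []) , 0≤-⇒≤ (nonNeg-≡ (R + R - V - 1ℤ) (solve (R ∷ V ∷ [])) (<⇒0≤-1 V<2R)))
    from : DoubleCondition R M (M + M) V → M ≡ V - R + + 2
    from (inj₁ (refl , 2M-4≤V)) = ⊥-elim (-1≱0 (nonNeg-≡ (((M - + 2) + (M - + 2) - V - 1ℤ) + (V - (M + M - + 4)))
      (solve (M ∷ V ∷ [])) (+-nonNeg (<⇒0≤-1 V<2R) (≤⇒0≤- 2M-4≤V))))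
    from (inj₂ (refl , _)) = solve (M ∷ V ∷ [])

  consecutive-count⇔ : ∀ {R M 2M V C} → 2M ≡ M + M →
                       (C ≡ R + + 2 × R + R < V) ⊎ (C ≡ V - R + + 1 × V ≤ R + R) →
                       M ≡ C ⇔ ConsecutiveCondition R M 2M V
  consecutive-count⇔ {R} {M} {_} {V} refl (inj₁ (refl , 2R<V)) = mk⇔ to from
    where
    to : M ≡ R + + 2 → ConsecutiveCondition R M (M + M) V
    to refl = inj₁ (solve (R ∷ []) , 0≤-⇒≤ (nonNeg-≡ (V - (R + R) - 1ℤ) (solve (R ∷ V ∷ [])) (<⇒0≤-1 2R<V)))
    from : ConsecutiveCondition R M (M + M) V → M ≡ R + + 2
    from (inj₁ (refl , _)) = solve (M ∷ [])
    from (inj₂ (refl , 2M-2≤V)) = ⊥-elim (-1≱0 (nonNeg-≡ ((V - (R + R) - 1ℤ) + (V - (M + M - + 2))) (solve (M ∷ V ∷ []))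
      (+-nonNeg (<⇒0≤-1 2R<V) (≤⇒0≤- 2M-2≤V))))
  consecutive-count⇔ {R} {M} {_} {V} refl (inj₂ (refl , V≤2R)) = mk⇔ to from
    where
    to : M ≡ V - R + + 1 → ConsecutiveCondition R M (M + M) V
    to refl = inj₂ (solve (R ∷ V ∷ []) , 0≤-⇒≤ (nonNeg-≡ (R + R - V) (solve (R ∷ V ∷ [])) (≤⇒0≤- V≤2R)))
    from : ConsecutiveCondition R M (M + M) V → M ≡ V - R + + 1
    from (inj₁ (refl , 2M-3≤V)) = ⊥-elim (-1≱0 (nonNeg-≡ (((M - + 2) + (M - + 2) - V) + (V - (M + M - + 3)))
      (solve (M ∷ V ∷ [])) (+-nonNeg (≤⇒0≤- V≤2R) (≤⇒0≤- 2M-3≤V))))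
    from (inj₂ (refl , _)) = solve (M ∷ V ∷ [])

  ⊓-∸-cases : ∀ r r′ U → r′ ℕ.≤ U →
              (+ (r ℕ.⊓ (U ∸ r′)) ≡ + r × + r + + r′ ≤ + U)
            ⊎ (+ (r ℕ.⊓ (U ∸ r′)) ≡ + U - + r′ × + U < + r + + r′)
  ⊓-∸-cases r r′ U r′≤U with r ℕ.≤? U ∸ r′
  ... | yes r≤U-r′ = inj₁ (cong +_ (ℕ.m≤n⇒m⊓n≡m r≤U-r′) , +≤+ (ℕ.m≤o∸n⇒m+n≤o r r′≤U r≤U-r′))
  ... | no  r≰U-r′ = inj₂ (trans (cong +_ (ℕ.m≥n⇒m⊓n≡n (ℕ.<⇒≤ U-r′<r)))
                                 (sym (trans (m-n≡m⊖n U r′) (⊖-≥ r′≤U))) ,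
                           +<+ (subst (ℕ._< r ℕ.+ r′) (ℕ.m∸n+n≡m r′≤U) (ℕ.+-monoˡ-< r′ U-r′<r)))
    where
    U-r′<r : U ∸ r′ ℕ.< r
    U-r′<r = ℕ.≰⇒> r≰U-r′

  +[2*m]≡m+m : ∀ m → + (2 ℕ.* m) ≡ + m + + m
  +[2*m]≡m+m m = cong (λ n → + (m ℕ.+ n)) (ℕ.+-identityʳ m)

  ℕ≡⇔+≡ : ∀ {m n} → m ≡ n ⇔ + m ≡ + n
  ℕ≡⇔+≡ = mk⇔ (cong (λ n → + n)) +-injective

  double-condition : ∀ {r m U V} → V ≡ + U → r ℕ.≤ U →
                     m ≡ 2 ℕ.+ r ℕ.⊓ (U ∸ r) ⇔ DoubleCondition (+ r) (+ m) (+ (2 ℕ.* m)) V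
  double-condition {r} {m} {U} refl r≤U = ⇔.trans ℕ≡⇔+≡ (double-count⇔ (+[2*m]≡m+m m) count)
    where
    count : (+ 2 + + (r ℕ.⊓ (U ∸ r)) ≡ + r + + 2 × + r + + r ≤ + U)
          ⊎ (+ 2 + + (r ℕ.⊓ (U ∸ r)) ≡ + U - + r + + 2 × + U < + r + + r)
    count with ⊓-∸-cases r r U r≤U
    ... | inj₁ (c≡r , 2r≤U)   = inj₁ (trans (+-comm (+ 2) (+ (r ℕ.⊓ (U ∸ r)))) (cong (_+ + 2) c≡r) , 2r≤U)
    ... | inj₂ (c≡U-r , U<2r) = inj₂ (trans (+-comm (+ 2) (+ (r ℕ.⊓ (U ∸ r)))) (cong (_+ + 2) c≡U-r) , U<2r)

  consecutive-condition : ∀ {r m U V} → V ≡ + U → r ℕ.< U →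
                          m ≡ 2 ℕ.+ r ℕ.⊓ (U ∸ ℕ.suc r) ⇔ ConsecutiveCondition (+ r) (+ m) (+ (2 ℕ.* m)) V
  consecutive-condition {r} {m} {U} refl r<U = ⇔.trans ℕ≡⇔+≡ (consecutive-count⇔ (+[2*m]≡m+m m) count)
    where
    count : (+ 2 + + (r ℕ.⊓ (U ∸ ℕ.suc r)) ≡ + r + + 2 × + r + + r < + U)
          ⊎ (+ 2 + + (r ℕ.⊓ (U ∸ ℕ.suc r)) ≡ + U - + r + + 1 × + U ≤ + r + + r)
    count with ⊓-∸-cases r (ℕ.suc r) U r<U
    ... | inj₁ (c≡r , r+[1+r]≤U) =
      inj₁ (trans (+-comm (+ 2) (+ (r ℕ.⊓ (U ∸ ℕ.suc r)))) (cong (_+ + 2) c≡r) ,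
            +<+ (subst (ℕ._≤ U) (ℕ.+-suc r r) (drop‿+≤+ r+[1+r]≤U)))
    ... | inj₂ (c≡U-1-r , U<r+[1+r]) =
      inj₂ (trans (cong (λ c → + 2 + c) c≡U-1-r) (identity (+ U) (+ r)) ,
            +≤+ (ℕ.s≤s⁻¹ (subst (U ℕ.<_) (ℕ.+-suc r r) (drop‿+<+ U<r+[1+r]))))
      where
      identity : ∀ U r → + 2 + (U - (1ℤ + r)) ≡ U - r + + 1
      identity = solve-∀

open Floors using (isqrt-sq<)
open Partitions using (PartitionCount⇔≡)
open Conditions using (double-condition; consecutive-condition)
import Data.Nat.Properties as ℕ
import Function.Properties.Equivalence as ⇔
open import Data.Integer.Properties using (drop‿+<+)
open import Data.Product using (_,_)
open import Relation.Binary.PropositionalEquality using (subst)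
open import Data.Nat using (_≤_; _<_)

lemma7p3 : (D : ℕ) → 2 ≤ D → SquareFree D →
           (m : ℕ) → 1 ≤ m → (k r : ℕ) →
           + r ℤ.< u D (2 ℕ.* k ℕ.+ 1) →
           (PartitionCount D (2 ⊙ alphaSR D (2 ℕ.* k) r) m ⇔
             ((+ r ≡ + m - + 2 × + (2 ℕ.* m) - + 4 ℤ.≤ u D (2 ℕ.* k ℕ.+ 1))
              ⊎ (+ r ≡ u D (2 ℕ.* k ℕ.+ 1) - (+ m - + 2) × + (2 ℕ.* m) - + 3 ℤ.≤ u D (2 ℕ.* k ℕ.+ 1))))
           × (PartitionCount D (alphaSR D (2 ℕ.* k) r ⊕ alphaSR D (2 ℕ.* k) (ℕ.suc r)) m ⇔
             ((+ r ≡ + m - + 2 × + (2 ℕ.* m) - + 3 ℤ.≤ u D (2 ℕ.* k ℕ.+ 1))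
              ⊎ (+ r ≡ u D (2 ℕ.* k ℕ.+ 1) - (+ m - + 1) × + (2 ℕ.* m) - + 2 ℤ.≤ u D (2 ℕ.* k ℕ.+ 1))))
lemma7p3 D 2≤D squarefree m _ k r r<u =
    ⇔.trans (PartitionCount⇔≡ (partitionCount-double r r<U) m) (double-condition u≡∣U∣ (ℕ.<⇒≤ r<U))
  , ⇔.trans (PartitionCount⇔≡ (partitionCount-consecutive r r<U) m) (consecutive-condition u≡∣U∣ r<U)
  where
  open Convergents D (isqrt-sq< D 2≤D squarefree)
  open Even k
  r<U : r < ∣U∣
  r<U = drop‿+<+ (subst (+ r ℤ.<_) u≡∣U∣ r<u)
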